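{- The reduction $\to^{[/]}$ on $\Lambda_{\circledR}^{[/]}$ terminates: there is no infinite sequence $Q_0\to^{[/]}Q_1\to^{[/]}\cdots$ of terms of $\Lambda_{\circledR}^{[/]}$.
   Context: Fix a countably infinite set of variables. The set $\Lambda_{\circledR}$ of terms and $Fv(M)$ are defined simultaneously: every variable $x$ is a term with $Fv(x)=\{x\}$; $\lambda x.M$ is a term if $M$ is a term and $x\in Fv(M)$ ($Fv=Fv(M)\setminus\{x\}$); $MN$ is a term if $M,N$ are terms with $Fv(M)\cap Fv(N)=\emptyset$ ($Fv=Fv(M)\cup Fv(N)$); $x\odot M$ (erasure) is a term if $M$ is a term and $x\notin Fv(M)$ ($Fv=\{x\}\cup Fv(M)$); $x<^{x_1}_{x_2}M$ (duplication) is a term if $M$ is a term, $x_1,x_2\in Fv(M)$, $x_1\neq x_2$, $x\notin Fv(M)\setminus\{x_1,x_2\}$ ($Fv=\{x\}\cup(Fv(M)\setminus\{x_1,x_2\})$). $\lambda x$ binds $x$, duplication binds $x_1,x_2$; $\alpha$-conversion and Barendregt's convention are assumed. $Fv[M]$ is the ordered list of free variables. For lists $X,Y,Z$ of equal length, $X\odot M$ and $X<^{Y}_{Z}M$ denote iterated erasures/duplications ($=M$ for empty lists). The set $\Lambda_{\circledR}^{[/]}$ and $Fv^{[/]}$ are defined by the same clauses (with $Fv^{[/]}$ in place of $Fv$) plus: $M[N/x]\in\Lambda_{\circledR}^{[/]}$ if $M\in\Lambda_{\circledR}^{[/]}$, $x\in Fv^{[/]}(M)$, $N\in\Lambda_{\circledR}$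 and $(Fv^{[/]}(M)\setminus\{x\})\cap Fv(N)=\emptyset$, with $Fv^{[/]}(M[N/x])=(Fv^{[/]}(M)\setminus\{x\})\cup Fv(N)$ ($x$ is bound in $M$). The one-step relation $\to^{[/]}$ is closed under $\alpha$-equivalence and contexts and given by: $x[N/x]\to N$; $(\lambda y.M)[N/x]\to\lambda y.M[N/x]$ ($x\ne y$); $(MP)[N/x]\to M[N/x]P$ if $x\in Fv^{[/]}(M)$; $(MP)[N/x]\to M\,P[N/x]$ if $x\in Fv^{[/]}(P)$; $(y\odot M)[N/x]\to y\odot M[N/x]$ ($x\neq y$); $(x\odot M)[N/x]\to Fv(N)\odot M$; $(y<^{y_1}_{y_2}M)[N/x]\to y<^{y_1}_{y_2}M[N/x]$ ($x\ne y$); $(x<^{x_1}_{x_2}M)[N/x]\to Fv[N]<^{Fv[N_1]}_{Fv[N_2]}M[N_1/x_1][N_2/x_2]$, with $N_1,N_2$ obtained from $N$ by renaming all free variables to fresh ones. -}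

module Defs where

open import Data.Nat using (ℕ; _≡ᵇ_)
open import Data.Bool using (Bool; true; false; if_then_else_; not)
open import Data.List using (List; []; _∷_; _++_; length; filterᵇ; foldr; zip)
open import Data.List.Membership.Propositional using (_∈_; _∉_)
open import Data.List.Relation.Unary.All using (All)
open import Data.List.Relation.Unary.Unique.Propositional using (Unique)
open import Data.Product using (_×_; _,_; Σ)
open import Data.Empty using (⊥)
open import Relation.Binary.PropositionalEquality using (_≡_)
open import Relation.Nullary using (¬_)

Var : Set
Var = ℕ

data Term : Set where
  var : Var → Term
  lam : Var → Term → Term
  app : Term → Term → Term
  era : Var → Term → Term                   -- x ⊙ M
  dup : Var → Var → Var → Term → Term       -- x <^{x1}_{x2} M   (dup x x1 x2 M)
  sub : Term → Var → Term → Term            -- M[N/x]            (sub M x N)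

_∖_ : List Var → Var → List Var
xs ∖ x = filterᵇ (λ y → not (y ≡ᵇ x)) xs

-- Ordered list of free variables Fv[M] (Fv and Fv^{[/]} coincide on Λ_®).
fv : Term → List Var
fv (var x) = x ∷ []
fv (lam x M) = fv M ∖ x
fv (app M N) = fv M ++ fv N
fv (era x M) = x ∷ fv M
fv (dup x x₁ x₂ M) = x ∷ ((fv M ∖ x₁) ∖ x₂)
fv (sub M x N) = (fv M ∖ x) ++ fv N

vars : Term → List Var
vars (var x) = x ∷ []
vars (lam x M) = x ∷ vars M
vars (app M N) = vars M ++ vars N
vars (era x M) = x ∷ vars M
vars (dup x x₁ x₂ M) = x ∷ x₁ ∷ x₂ ∷ vars M
vars (sub M x N) = x ∷ vars M ++ vars N

Disjoint : List Var → List Var → Set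
Disjoint xs ys = ∀ {z} → z ∈ xs → z ∈ ys → ⊥

data Λ® : Term → Set where
  var : ∀ x → Λ® (var x)
  lam : ∀ x M → Λ® M → x ∈ fv M → Λ® (lam x M)
  app : ∀ M N → Λ® M → Λ® N → Disjoint (fv M) (fv N) → Λ® (app M N)
  era : ∀ x M → Λ® M → x ∉ fv M → Λ® (era x M)
  dup : ∀ x x₁ x₂ M → Λ® M → x₁ ∈ fv M → x₂ ∈ fv M → ¬ (x₁ ≡ x₂) →
        x ∉ ((fv M ∖ x₁) ∖ x₂) → Λ® (dup x x₁ x₂ M)

data Λ®[/] : Term → Set where
  var : ∀ x → Λ®[/] (var x)
  lam : ∀ x M → Λ®[/] M → x ∈ fv M → Λ®[/] (lam x M)
  app : ∀ M N → Λ®[/] M → Λ®[/] N → Disjoint (fv M) (fv N) → Λ®[/] (app M N)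
  era : ∀ x M → Λ®[/] M → x ∉ fv M → Λ®[/] (era x M)
  dup : ∀ x x₁ x₂ M → Λ®[/] M → x₁ ∈ fv M → x₂ ∈ fv M → ¬ (x₁ ≡ x₂) →
        x ∉ ((fv M ∖ x₁) ∖ x₂) → Λ®[/] (dup x x₁ x₂ M)
  sub : ∀ M x N → Λ®[/] M → x ∈ fv M → Λ® N →
        Disjoint (fv M ∖ x) (fv N) → Λ®[/] (sub M x N)

-- Renaming of the free occurrences of x by y: M{y/x}.
-- (Capture-avoiding whenever y does not occur in M, which is how it is used.)
ren : Var → Var → Term → Term
ren x y (var z) = var (if z ≡ᵇ x then y else z)
ren x y (lam z M) = lam z (if z ≡ᵇ x then M else ren x y M)
ren x y (app M N) = app (ren x y M) (ren x y N)
ren x y (era z M) = era (if z ≡ᵇ x then y else z) (ren x y M)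
ren x y (dup z z₁ z₂ M) =
  dup (if z ≡ᵇ x then y else z) z₁ z₂
      (if z₁ ≡ᵇ x then M else if z₂ ≡ᵇ x then M else ren x y M)
ren x y (sub M z N) = sub (if z ≡ᵇ x then M else ren x y M) z (ren x y N)

-- Renaming along a list of pairs (used with pairwise distinct fresh targets).
rens : List (Var × Var) → Term → Term
rens ps M = foldr (λ { (x , y) N → ren x y N }) M ps

eras : List Var → Term → Term
eras [] M = M
eras (x ∷ X) M = era x (eras X M)

-- Iterated duplication X <^{Y}_{Z} M  (lists of equal length)
dups : List Var → List Var → List Var → Term → Term
dups (x ∷ X) (y ∷ Y) (z ∷ Z) M = dup x y z (dups X Y Z M)
dups _ _ _ M = M

data _~α₀_ : Term → Term → Set where
  lam : ∀ x y M → y ∉ vars M → lam x M ~α₀ lam y (ren x y M)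
  dup₁ : ∀ z x₁ x₂ y M → y ∉ vars M → dup z x₁ x₂ M ~α₀ dup z y x₂ (ren x₁ y M)
  dup₂ : ∀ z x₁ x₂ y M → y ∉ vars M → dup z x₁ x₂ M ~α₀ dup z x₁ y (ren x₂ y M)
  sub : ∀ M x N y → y ∉ vars M → sub M x N ~α₀ sub (ren x y M) y N

data _≡α_ : Term → Term → Set where
  base : ∀ {M N} → M ~α₀ N → M ≡α N
  refl : ∀ {M} → M ≡α M
  sym : ∀ {M N} → M ≡α N → N ≡α M
  trans : ∀ {M N P} → M ≡α N → N ≡α P → M ≡α P
  lam : ∀ x {M M'} → M ≡α M' → lam x M ≡α lam x M'
  app : ∀ {M M' N N'} → M ≡α M' → N ≡α N' → app M N ≡α app M' N'
  era : ∀ x {M M'} → M ≡α M' → era x M ≡α era x M'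
  dup : ∀ x x₁ x₂ {M M'} → M ≡α M' → dup x x₁ x₂ M ≡α dup x x₁ x₂ M'
  sub : ∀ x {M M' N N'} → M ≡α M' → N ≡α N' → sub M x N ≡α sub M' x N'

data _⟶₀_ : Term → Term → Set where
  r-var : ∀ x N → sub (var x) x N ⟶₀ N
  r-lam : ∀ y M x N → ¬ (x ≡ y) → y ∉ fv N →
          sub (lam y M) x N ⟶₀ lam y (sub M x N)
  r-appˡ : ∀ M P x N → x ∈ fv M →
          sub (app M P) x N ⟶₀ app (sub M x N) P
  r-appʳ : ∀ M P x N → x ∈ fv P →
          sub (app M P) x N ⟶₀ app M (sub P x N)
  r-era : ∀ y M x N → ¬ (x ≡ y) →
          sub (era y M) x N ⟶₀ era y (sub M x N)
  r-era-x : ∀ M x N → sub (era x M) x N ⟶₀ eras (fv N) M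
  r-dup : ∀ y y₁ y₂ M x N → ¬ (x ≡ y) → y₁ ∉ fv N → y₂ ∉ fv N →
          sub (dup y y₁ y₂ M) x N ⟶₀ dup y y₁ y₂ (sub M x N)
  -- N₁, N₂ : N with its free variables Fv[N] renamed to fresh Y resp. Z
  r-dup-x : ∀ x₁ x₂ M x N (Y Z : List Var) →
          length Y ≡ length (fv N) → length Z ≡ length (fv N) →
          Unique (Y ++ Z) →
          All (λ v → v ∉ vars (sub (dup x x₁ x₂ M) x N)) (Y ++ Z) →
          sub (dup x x₁ x₂ M) x N ⟶₀
            dups (fv N) Y Z (sub (sub M x₁ (rens (zip (fv N) Y) N)) x₂ (rens (zip (fv N) Z) N))

data _⟶c_ : Term → Term → Set where
  root : ∀ {M N} → M ⟶₀ N → M ⟶c N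
  lam : ∀ x {M M'} → M ⟶c M' → lam x M ⟶c lam x M'
  appˡ : ∀ {M M'} N → M ⟶c M' → app M N ⟶c app M' N
  appʳ : ∀ M {N N'} → N ⟶c N' → app M N ⟶c app M N'
  era : ∀ x {M M'} → M ⟶c M' → era x M ⟶c era x M'
  dup : ∀ x x₁ x₂ {M M'} → M ⟶c M' → dup x x₁ x₂ M ⟶c dup x x₁ x₂ M'
  subˡ : ∀ {M M'} x N → M ⟶c M' → sub M x N ⟶c sub M' x N
  subʳ : ∀ M x {N N'} → N ⟶c N' → sub M x N ⟶c sub M x N'

_⟶[/]_ : Term → Term → Set
M ⟶[/] N = Σ Term λ M' → Σ Term λ N' → M ≡α M' × M' ⟶c N' × N' ≡α N

module Submission where

-- We interpret terms in ℕ.  Given weights ρ for the variables, φ M ρ is the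
-- total weight of the free-variable occurrences of M, and ⟦ M ⟧ ρ > φ M ρ is a
-- polynomial measure in which a substitution M[N/x] lets x weigh Wt (⟦ N ⟧ ρ),
-- more than anything N itself contributes.
-- So ⟦ Qₙ ⟧ (under the zero environment) would descend forever in ℕ.

open import Defs
open import Data.Bool using (true; false; if_then_else_; not; T)
open import Data.Bool.Properties using (T-≡)
open import Data.Empty using (⊥; ⊥-elim)
open import Data.List using (List; []; _∷_; _++_; map; length; zip)
open import Data.List.Membership.Propositional using (_∈_; _∉_)
open import Data.List.Membership.Propositional.Properties
  using (∈-map⁺; ∈-map⁻; ∈-++⁺ˡ; ∈-++⁺ʳ; ∈-++⁻; ∈-filter⁻; ∈-filter⁺)
open import Data.List.Properties using (map-++)
open import Data.List.Relation.Binary.Subset.Propositional using (_⊆_)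
open import Data.List.Relation.Binary.Subset.Propositional.Properties using (∷⁺ʳ)
open import Data.List.Relation.Unary.All using (All; []; _∷_)
import Data.List.Relation.Unary.All as All
open import Data.List.Relation.Unary.All.Properties using (++⁻ˡ; ++⁻ʳ)
open import Data.List.Relation.Unary.AllPairs using ([]; _∷_)
open import Data.List.Relation.Unary.Any using (here; there)
open import Data.List.Relation.Unary.Unique.Propositional using (Unique)
open import Data.List.Relation.Unary.Unique.Propositional.Properties using (Unique[x∷xs]⇒x∉xs)
open import Data.Nat using (ℕ; suc; _+_; _*_; _≤_; _<_; _≡ᵇ_; _≟_; z≤n; s≤s)
open import Data.Nat.Induction using (<-wellFounded)
open import Data.List.Membership.DecPropositional _≟_ using (_∈?_)
open import Data.Nat.Properties
open import Data.Nat.Tactic.RingSolver using (solve-∀)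
open import Data.Product using (Σ; _×_; _,_; proj₁; proj₂; ∃-syntax)
open import Data.Product.Function.NonDependent.Propositional using (_×-⇔_)
open import Data.Sum using (inj₁; inj₂)
open import Data.Unit using (⊤; tt)
open import Function using (_∘_; _⇔_; mk⇔; Equivalence)
open import Function.Construct.Composition using (_⇔-∘_)
open import Function.Construct.Identity using (⇔-id)
open import Function.Construct.Symmetry using (⇔-sym)
open import Induction.WellFounded using (Acc; acc)
open import Relation.Nullary using (¬_; yes; no)
open import Relation.Nullary.Decidable using (T?)
open import Relation.Binary.PropositionalEquality
  using (_≡_; _≢_; refl; cong; cong₂; subst; subst₂; ≢-sym; module ≡-Reasoning)
  renaming (sym to ≡-sym; trans to ≡-trans)

open Equivalence using (to; from)

≡ᵇ-refl : ∀ n → (n ≡ᵇ n) ≡ true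
≡ᵇ-refl n = to T-≡ (≡⇒≡ᵇ n n refl)

≡ᵇ-true⇒≡ : ∀ m n → (m ≡ᵇ n) ≡ true → m ≡ n
≡ᵇ-true⇒≡ m n e = ≡ᵇ⇒≡ m n (from T-≡ e)

≡ᵇ-false⇒≢ : ∀ m n → (m ≡ᵇ n) ≡ false → m ≢ n
≡ᵇ-false⇒≢ m n e m≡n = subst T e (≡⇒≡ᵇ m n m≡n)

≢⇒≡ᵇ-false : ∀ m n → m ≢ n → (m ≡ᵇ n) ≡ false
≢⇒≡ᵇ-false m n m≢n with m ≡ᵇ n in e
... | true = ⊥-elim (m≢n (≡ᵇ-true⇒≡ m n e))
... | false = refl

∈-∖⁻ : ∀ {z x} l → z ∈ l ∖ x → z ∈ l × z ≢ x
∈-∖⁻ {x = x} l p with ∈-filter⁻ (λ y → T? (not (y ≡ᵇ x))) {xs = l} p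
... | q , keep = q , λ { refl → subst (T ∘ not) (≡ᵇ-refl x) keep }

∈-∖⁺ : ∀ {z x} l → z ∈ l → z ≢ x → z ∈ l ∖ x
∈-∖⁺ {z} {x} l p z≢x =
  ∈-filter⁺ (λ y → T? (not (y ≡ᵇ x))) p (subst (T ∘ not) (≡-sym (≢⇒≡ᵇ-false z x z≢x)) _)

∉-∖-self : ∀ l x → x ∉ l ∖ x
∉-∖-self l x p = proj₂ (∈-∖⁻ l p) refl

∖-cons-≡ : ∀ l z → (z ∷ l) ∖ z ≡ l ∖ z
∖-cons-≡ l z rewrite ≡ᵇ-refl z = refl

∖-cons-≢ : ∀ w l z → w ≢ z → (w ∷ l) ∖ z ≡ w ∷ (l ∖ z)
∖-cons-≢ w l z w≢z rewrite ≢⇒≡ᵇ-false w z w≢z = refl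

Env : Set
Env = ℕ → ℕ

_[_≔_] : Env → Var → ℕ → Env
(ρ [ x ≔ a ]) v = if v ≡ᵇ x then a else ρ v

_≐_ : Env → Env → Set
ρ ≐ σ = ∀ v → ρ v ≡ σ v

Agree : List Var → Env → Env → Set
Agree l ρ σ = ∀ v → v ∈ l → ρ v ≡ σ v

_≤ᵉ_ : Env → Env → Set
ρ ≤ᵉ σ = ∀ v → ρ v ≤ σ v

upd-same : ∀ ρ x a → (ρ [ x ≔ a ]) x ≡ a
upd-same ρ x a rewrite ≡ᵇ-refl x = refl

upd-other : ∀ ρ x a v → v ≢ x → (ρ [ x ≔ a ]) v ≡ ρ v
upd-other ρ x a v v≢x rewrite ≢⇒≡ᵇ-false v x v≢x = refl

upd²-first : ∀ ρ p q a → (ρ [ p ≔ a ] [ q ≔ a ]) p ≡ a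
upd²-first ρ p q a with p ≡ᵇ q
... | true = refl
... | false = upd-same ρ p a

agree-fresh : ∀ ρ y a l → y ∉ l → Agree l (ρ [ y ≔ a ]) ρ
agree-fresh ρ y a l y∉l v p = upd-other ρ y a v λ { refl → y∉l p }

agree-fresh² : ∀ ρ y z a l → y ∉ l → z ∉ l → Agree l (ρ [ y ≔ a ] [ z ≔ a ]) ρ
agree-fresh² ρ y z a l y∉l z∉l v p =
  ≡-trans (agree-fresh (ρ [ y ≔ a ]) z a l z∉l v p) (agree-fresh ρ y a l y∉l v p)

agree-∖ : ∀ ρ x a l → Agree (l ∖ x) (ρ [ x ≔ a ]) ρ
agree-∖ ρ x a l v p = upd-other ρ x a v (proj₂ (∈-∖⁻ l p))

agree-∖² : ∀ ρ x₁ x₂ a l → Agree ((l ∖ x₁) ∖ x₂) (ρ [ x₁ ≔ a ] [ x₂ ≔ a ]) ρ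
agree-∖² ρ x₁ x₂ a l v p with ∈-∖⁻ (l ∖ x₁) p
... | q , v≢x₂ = ≡-trans (upd-other (ρ [ x₁ ≔ a ]) x₂ a v v≢x₂) (agree-∖ ρ x₁ a l v q)

agree-bind : ∀ l ρ σ x a → Agree (l ∖ x) ρ σ → Agree l (ρ [ x ≔ a ]) (σ [ x ≔ a ])
agree-bind l ρ σ x a h v p with v ≡ᵇ x in e
... | true = refl
... | false = h v (∈-∖⁺ l p (≡ᵇ-false⇒≢ v x e))

agree-bind² : ∀ l ρ σ x₁ x₂ a → Agree ((l ∖ x₁) ∖ x₂) ρ σ →
              Agree l (ρ [ x₁ ≔ a ] [ x₂ ≔ a ]) (σ [ x₁ ≔ a ] [ x₂ ≔ a ])
agree-bind² l ρ σ x₁ x₂ a h = agree-bind l _ _ x₂ a (agree-bind (l ∖ x₂) ρ σ x₁ a h′)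
  where
  h′ : Agree ((l ∖ x₂) ∖ x₁) ρ σ
  h′ v p with ∈-∖⁻ (l ∖ x₂) p
  ... | q , v≢x₁ with ∈-∖⁻ l q
  ... | r , v≢x₂ = h v (∈-∖⁺ (l ∖ x₁) (∈-∖⁺ l r v≢x₁) v≢x₂)

agree-++ˡ : ∀ l k {ρ σ} → Agree (l ++ k) ρ σ → Agree l ρ σ
agree-++ˡ l k h v p = h v (∈-++⁺ˡ p)

agree-++ʳ : ∀ l k {ρ σ} → Agree (l ++ k) ρ σ → Agree k ρ σ
agree-++ʳ l k h v p = h v (∈-++⁺ʳ l p)

upd-mono : ∀ ρ σ x a b → ρ ≤ᵉ σ → a ≤ b → (ρ [ x ≔ a ]) ≤ᵉ (σ [ x ≔ b ])
upd-mono ρ σ x a b ρ≤σ a≤b v with v ≡ᵇ x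
... | true = a≤b
... | false = ρ≤σ v

upd-cong : ∀ ρ σ x a → ρ ≐ σ → (ρ [ x ≔ a ]) ≐ (σ [ x ≔ a ])
upd-cong ρ σ x a h v with v ≡ᵇ x
... | true = refl
... | false = h v

upd-shadow : ∀ ρ x a b → (ρ [ x ≔ a ] [ x ≔ b ]) ≐ (ρ [ x ≔ b ])
upd-shadow ρ x a b v with v ≡ᵇ x
... | true = refl
... | false = refl

upd-comm : ∀ ρ x z a b → x ≢ z → (ρ [ z ≔ a ] [ x ≔ b ]) ≐ (ρ [ x ≔ b ] [ z ≔ a ])
upd-comm ρ x z a b x≢z v with v ≡ᵇ x in e₁ | v ≡ᵇ z in e₂
... | true | true = ⊥-elim (x≢z (≡-trans (≡-sym (≡ᵇ-true⇒≡ v x e₁)) (≡ᵇ-true⇒≡ v z e₂)))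
... | true | false = refl
... | false | true = refl
... | false | false = refl

upd-swap : ∀ ρ p q a → (ρ [ p ≔ a ] [ q ≔ a ]) ≐ (ρ [ q ≔ a ] [ p ≔ a ])
upd-swap ρ p q a v with v ≡ᵇ p | v ≡ᵇ q
... | true | true = refl
... | true | false = refl
... | false | true = refl
... | false | false = refl

≐-sym : ∀ {ρ σ} → ρ ≐ σ → σ ≐ ρ
≐-sym h v = ≡-sym (h v)

≐-trans : ∀ {ρ σ τ} → ρ ≐ σ → σ ≐ τ → ρ ≐ τ
≐-trans h k v = ≡-trans (h v) (k v)

-- The interpretation.  φ M ρ is the total weight of the free-variable
-- occurrences of M (a duplicated variable passes its weight to both copies,
-- a substituted one receives the weight of the substituted term).  ⟦ M ⟧ ρ
-- is the termination measure; under a substitution M[N/x] the variable x is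
-- given the weight `Wt ⟦ N ⟧`, strictly larger than anything N contributes.

φ : Term → Env → ℕ
φ (var x) ρ = ρ x
φ (lam x M) ρ = φ M (ρ [ x ≔ 0 ])
φ (app M N) ρ = φ M ρ + φ N ρ
φ (era x M) ρ = ρ x + φ M ρ
φ (dup x x₁ x₂ M) ρ = φ M (ρ [ x₁ ≔ ρ x ] [ x₂ ≔ ρ x ])
φ (sub M x N) ρ = φ M (ρ [ x ≔ φ N ρ ])

Wt : ℕ → ℕ
Wt n = suc (suc (n + n))

⟦_⟧ : Term → Env → ℕ
⟦ var x ⟧ ρ = suc (ρ x)
⟦ lam x M ⟧ ρ = suc (φ M (ρ [ x ≔ 0 ])) + ⟦ M ⟧ (ρ [ x ≔ 0 ])
⟦ app M N ⟧ ρ = suc (φ M ρ + φ N ρ) + (⟦ M ⟧ ρ + ⟦ N ⟧ ρ)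
⟦ era x M ⟧ ρ = suc (ρ x) * suc (ρ x + φ M ρ) + ⟦ M ⟧ ρ
⟦ dup x x₁ x₂ M ⟧ ρ =
  suc (ρ x) * suc (φ M (ρ [ x₁ ≔ ρ x ] [ x₂ ≔ ρ x ])) + ⟦ M ⟧ (ρ [ x₁ ≔ ρ x ] [ x₂ ≔ ρ x ])
⟦ sub M x N ⟧ ρ = suc (φ M (ρ [ x ≔ φ N ρ ])) + ⟦ N ⟧ ρ + ⟦ M ⟧ (ρ [ x ≔ Wt (⟦ N ⟧ ρ) ])

DependsOnFv : (Term → Env → ℕ) → Set
DependsOnFv F = ∀ M ρ σ → Agree (fv M) ρ σ → F M ρ ≡ F M σ

φ-fv : DependsOnFv φ
φ-fv (var x) ρ σ h = h x (here refl)
φ-fv (lam x M) ρ σ h = φ-fv M _ _ (agree-bind (fv M) ρ σ x 0 h)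
φ-fv (app M N) ρ σ h =
  cong₂ _+_ (φ-fv M ρ σ (agree-++ˡ (fv M) (fv N) h)) (φ-fv N ρ σ (agree-++ʳ (fv M) (fv N) h))
φ-fv (era x M) ρ σ h = cong₂ _+_ (h x (here refl)) (φ-fv M ρ σ (λ v → h v ∘ there))
φ-fv (dup x x₁ x₂ M) ρ σ h rewrite h x (here refl) =
  φ-fv M _ _ (agree-bind² (fv M) ρ σ x₁ x₂ (σ x) (λ v → h v ∘ there))
φ-fv (sub M x N) ρ σ h rewrite φ-fv N ρ σ (agree-++ʳ (fv M ∖ x) (fv N) h) =
  φ-fv M _ _ (agree-bind (fv M) ρ σ x (φ N σ) (agree-++ˡ (fv M ∖ x) (fv N) h))

⟦⟧-fv : DependsOnFv ⟦_⟧
⟦⟧-fv (var x) ρ σ h = cong suc (h x (here refl))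
⟦⟧-fv (lam x M) ρ σ h =
  cong₂ (λ a b → suc a + b) (φ-fv M _ _ h′) (⟦⟧-fv M _ _ h′)
  where
  h′ : Agree (fv M) (ρ [ x ≔ 0 ]) (σ [ x ≔ 0 ])
  h′ = agree-bind (fv M) ρ σ x 0 h
⟦⟧-fv (app M N) ρ σ h =
  cong₂ (λ a b → suc a + b) (cong₂ _+_ (φ-fv M ρ σ hM) (φ-fv N ρ σ hN))
                            (cong₂ _+_ (⟦⟧-fv M ρ σ hM) (⟦⟧-fv N ρ σ hN))
  where
  hM : Agree (fv M) ρ σ
  hM = agree-++ˡ (fv M) (fv N) h
  hN : Agree (fv N) ρ σ
  hN = agree-++ʳ (fv M) (fv N) h
⟦⟧-fv (era x M) ρ σ h
  rewrite h x (here refl) | φ-fv M ρ σ (λ v → h v ∘ there) =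
  cong (suc (σ x) * suc (σ x + φ M σ) +_) (⟦⟧-fv M ρ σ (λ v → h v ∘ there))
⟦⟧-fv (dup x x₁ x₂ M) ρ σ h rewrite h x (here refl) =
  cong₂ (λ a b → suc (σ x) * suc a + b) (φ-fv M _ _ h′) (⟦⟧-fv M _ _ h′)
  where
  h′ : Agree (fv M) (ρ [ x₁ ≔ σ x ] [ x₂ ≔ σ x ]) (σ [ x₁ ≔ σ x ] [ x₂ ≔ σ x ])
  h′ = agree-bind² (fv M) ρ σ x₁ x₂ (σ x) (λ v → h v ∘ there)
⟦⟧-fv (sub M x N) ρ σ h
  rewrite φ-fv N ρ σ (agree-++ʳ (fv M ∖ x) (fv N) h) | ⟦⟧-fv N ρ σ (agree-++ʳ (fv M ∖ x) (fv N) h) =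
  cong₂ (λ a b → suc a + ⟦ N ⟧ σ + b) (φ-fv M _ _ (agree-bind (fv M) ρ σ x (φ N σ) hM))
                                      (⟦⟧-fv M _ _ (agree-bind (fv M) ρ σ x (Wt (⟦ N ⟧ σ)) hM))
  where
  hM : Agree (fv M ∖ x) ρ σ
  hM = agree-++ˡ (fv M ∖ x) (fv N) h

respects-≐ : ∀ F → DependsOnFv F → ∀ M {ρ σ} → ρ ≐ σ → F M ρ ≡ F M σ
respects-≐ F F-fv M h = F-fv M _ _ (λ v _ → h v)

φ-≐ : ∀ M {ρ σ} → ρ ≐ σ → φ M ρ ≡ φ M σ
φ-≐ = respects-≐ φ φ-fv

⟦⟧-≐ : ∀ M {ρ σ} → ρ ≐ σ → ⟦ M ⟧ ρ ≡ ⟦ M ⟧ σ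
⟦⟧-≐ = respects-≐ ⟦_⟧ ⟦⟧-fv

-- Λ® is exactly the substitution-free part of Λ®[/].

SubFree : Term → Set
SubFree (var x) = ⊤
SubFree (lam x M) = SubFree M
SubFree (app M N) = SubFree M × SubFree N
SubFree (era x M) = SubFree M
SubFree (dup x x₁ x₂ M) = SubFree M
SubFree (sub M x N) = ⊥

fromΛ® : ∀ {M} → Λ® M → Λ®[/] M
fromΛ® (var x) = var x
fromΛ® (lam x M w p) = lam x M (fromΛ® w) p
fromΛ® (app M N w₁ w₂ d) = app M N (fromΛ® w₁) (fromΛ® w₂) d
fromΛ® (era x M w p) = era x M (fromΛ® w) p
fromΛ® (dup x x₁ x₂ M w p₁ p₂ ne q) = dup x x₁ x₂ M (fromΛ® w) p₁ p₂ ne q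

Λ®⇒SubFree : ∀ {M} → Λ® M → SubFree M
Λ®⇒SubFree (var x) = tt
Λ®⇒SubFree (lam x M w p) = Λ®⇒SubFree w
Λ®⇒SubFree (app M N w₁ w₂ d) = Λ®⇒SubFree w₁ , Λ®⇒SubFree w₂
Λ®⇒SubFree (era x M w p) = Λ®⇒SubFree w
Λ®⇒SubFree (dup x x₁ x₂ M w p₁ p₂ ne q) = Λ®⇒SubFree w

toΛ® : ∀ {M} → Λ®[/] M → SubFree M → Λ® M
toΛ® (var x) _ = var x
toΛ® (lam x M w p) sf = lam x M (toΛ® w sf) p
toΛ® (app M N w₁ w₂ d) (sf₁ , sf₂) = app M N (toΛ® w₁ sf₁) (toΛ® w₂ sf₂) d
toΛ® (era x M w p) sf = era x M (toΛ® w sf) p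
toΛ® (dup x x₁ x₂ M w p₁ p₂ ne q) sf = dup x x₁ x₂ M (toΛ® w sf) p₁ p₂ ne q


+-exchange : ∀ d a b → d + (a + b) ≡ a + (d + b)
+-exchange = solve-∀

φ-mono : ∀ M ρ σ → ρ ≤ᵉ σ → φ M ρ ≤ φ M σ
φ-mono (var x) ρ σ h = h x
φ-mono (lam x M) ρ σ h = φ-mono M _ _ (upd-mono ρ σ x 0 0 h z≤n)
φ-mono (app M N) ρ σ h = +-mono-≤ (φ-mono M ρ σ h) (φ-mono N ρ σ h)
φ-mono (era x M) ρ σ h = +-mono-≤ (h x) (φ-mono M ρ σ h)
φ-mono (dup x x₁ x₂ M) ρ σ h = φ-mono M _ _ (upd-mono _ _ x₂ _ _ (upd-mono ρ σ x₁ _ _ h (h x)) (h x))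
φ-mono (sub M x N) ρ σ h = φ-mono M _ _ (upd-mono ρ σ x _ _ h (φ-mono N ρ σ h))

φ<⟦⟧ : ∀ M ρ → φ M ρ < ⟦ M ⟧ ρ
φ<⟦⟧ (var x) ρ = ≤-refl
φ<⟦⟧ (lam x M) ρ = s≤s (m≤m+n _ _)
φ<⟦⟧ (app M N) ρ = s≤s (m≤m+n _ _)
φ<⟦⟧ (era x M) ρ = ≤-trans (m≤n*m (suc (ρ x + φ M ρ)) (suc (ρ x))) (m≤m+n _ _)
φ<⟦⟧ (dup x x₁ x₂ M) ρ = ≤-trans (m≤n*m _ (suc (ρ x))) (m≤m+n _ _)
φ<⟦⟧ (sub M x N) ρ = s≤s (≤-trans (m≤m+n _ _) (m≤m+n _ _))

≤Wt : ∀ n → n ≤ Wt n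
≤Wt n = ≤-trans (m≤m+n n n) (≤-trans (n≤1+n _) (n≤1+n _))

φ<Wt⟦⟧ : ∀ N ρ → φ N ρ < Wt (⟦ N ⟧ ρ)
φ<Wt⟦⟧ N ρ = ≤-trans (φ<⟦⟧ N ρ) (≤Wt (⟦ N ⟧ ρ))

-- Strictness (uses well-formedness, i.e. linearity): raising the weight of a
-- free variable of M by d raises φ M by at least d.
φ-strict : ∀ M ρ σ x d → Λ®[/] M → x ∈ fv M → ρ ≤ᵉ σ → d + ρ x ≤ σ x → d + φ M ρ ≤ φ M σ
φ-strict (var z) ρ σ x d _ (here refl) _ h = h
φ-strict (lam z M) ρ σ x d (lam _ _ wM _) p ρ≤σ h with ∈-∖⁻ (fv M) p
... | q , x≢z =
  φ-strict M _ _ x d wM q (upd-mono ρ σ z 0 0 ρ≤σ z≤n)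
    (subst₂ (λ a b → d + a ≤ b) (≡-sym (upd-other ρ z 0 x x≢z)) (≡-sym (upd-other σ z 0 x x≢z)) h)
φ-strict (app M N) ρ σ x d (app _ _ wM wN _) p ρ≤σ h with ∈-++⁻ (fv M) p
... | inj₁ q = ≤-trans (≤-reflexive (≡-sym (+-assoc d _ _)))
                 (+-mono-≤ (φ-strict M ρ σ x d wM q ρ≤σ h) (φ-mono N ρ σ ρ≤σ))
... | inj₂ q = ≤-trans (≤-reflexive (+-exchange d (φ M ρ) (φ N ρ)))
                 (+-mono-≤ (φ-mono M ρ σ ρ≤σ) (φ-strict N ρ σ x d wN q ρ≤σ h))
φ-strict (era z M) ρ σ x d _ (here refl) ρ≤σ h =
  ≤-trans (≤-reflexive (≡-sym (+-assoc d _ _))) (+-mono-≤ h (φ-mono M ρ σ ρ≤σ))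
φ-strict (era z M) ρ σ x d (era _ _ wM _) (there p) ρ≤σ h =
  ≤-trans (≤-reflexive (+-exchange d (ρ z) (φ M ρ))) (+-mono-≤ (ρ≤σ z) (φ-strict M ρ σ x d wM p ρ≤σ h))
φ-strict (dup z z₁ z₂ M) ρ σ x d (dup _ _ _ _ wM p₁ _ _ _) (here refl) ρ≤σ h =
  φ-strict M _ _ z₁ d wM p₁ (upd-mono _ _ z₂ _ _ (upd-mono ρ σ z₁ _ _ ρ≤σ (ρ≤σ z)) (ρ≤σ z))
    (subst₂ (λ a b → d + a ≤ b) (≡-sym (upd²-first ρ z₁ z₂ (ρ z))) (≡-sym (upd²-first σ z₁ z₂ (σ z))) h)
φ-strict (dup z z₁ z₂ M) ρ σ x d (dup _ _ _ _ wM _ _ _ _) (there p) ρ≤σ h with ∈-∖⁻ (fv M ∖ z₁) p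
... | r , x≢z₂ with ∈-∖⁻ (fv M) r
... | s , x≢z₁ =
  φ-strict M _ _ x d wM s (upd-mono _ _ z₂ _ _ (upd-mono ρ σ z₁ _ _ ρ≤σ (ρ≤σ z)) (ρ≤σ z))
    (subst₂ (λ a b → d + a ≤ b) (≡-sym (unchanged ρ)) (≡-sym (unchanged σ)) h)
  where
  unchanged : ∀ τ → (τ [ z₁ ≔ τ z ] [ z₂ ≔ τ z ]) x ≡ τ x
  unchanged τ = ≡-trans (upd-other (τ [ z₁ ≔ τ z ]) z₂ (τ z) x x≢z₂) (upd-other τ z₁ (τ z) x x≢z₁)
φ-strict (sub M z N) ρ σ x d (sub _ _ _ wM _ _ _) p ρ≤σ h with ∈-++⁻ (fv M ∖ z) p
... | inj₁ q with ∈-∖⁻ (fv M) q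
... | r , x≢z =
  φ-strict M _ _ x d wM r (upd-mono ρ σ z _ _ ρ≤σ (φ-mono N ρ σ ρ≤σ))
    (subst₂ (λ a b → d + a ≤ b) (≡-sym (upd-other ρ z _ x x≢z)) (≡-sym (upd-other σ z _ x x≢z)) h)
φ-strict (sub M z N) ρ σ x d (sub _ _ _ wM z∈M wN _) p ρ≤σ h | inj₂ q =
  φ-strict M _ _ z d wM z∈M (upd-mono ρ σ z _ _ ρ≤σ (φ-mono N ρ σ ρ≤σ))
    (subst₂ (λ a b → d + a ≤ b) (≡-sym (upd-same ρ z _)) (≡-sym (upd-same σ z _))
       (φ-strict N ρ σ x d (fromΛ® wN) q ρ≤σ h))

Σ[_] : (Var → ℕ) → List Var → ℕ
Σ[ g ] [] = 0
Σ[ g ] (v ∷ l) = g v + Σ[ g ] l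

_⁺ : Env → Env
(ρ ⁺) v = suc (ρ v)

Σ-cong : ∀ {g h} l → (∀ {v} → v ∈ l → g v ≡ h v) → Σ[ g ] l ≡ Σ[ h ] l
Σ-cong [] e = refl
Σ-cong (v ∷ l) e = cong₂ _+_ (e (here refl)) (Σ-cong l (e ∘ there))

Σ-agree : ∀ l {ρ σ} → Agree l ρ σ → Σ[ ρ ] l ≡ Σ[ σ ] l
Σ-agree l h = Σ-cong l (h _)

Σ⁺-agree : ∀ l {ρ σ} → Agree l ρ σ → Σ[ ρ ⁺ ] l ≡ Σ[ σ ⁺ ] l
Σ⁺-agree l h = Σ-cong l (cong suc ∘ h _)

Σ-mono : ∀ {g h} l → (∀ v → g v ≤ h v) → Σ[ g ] l ≤ Σ[ h ] l
Σ-mono [] g≤h = z≤n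
Σ-mono (v ∷ l) g≤h = +-mono-≤ (g≤h v) (Σ-mono l g≤h)

Σ-++ : ∀ g l k → Σ[ g ] (l ++ k) ≡ Σ[ g ] l + Σ[ g ] k
Σ-++ g [] k = refl
Σ-++ g (v ∷ l) k = ≡-trans (cong (g v +_) (Σ-++ g l k)) (≡-sym (+-assoc (g v) _ _))

Σ-∖ : ∀ g l z → Σ[ g ] (l ∖ z) ≤ Σ[ g ] l
Σ-∖ g [] z = z≤n
Σ-∖ g (v ∷ l) z with v ≡ᵇ z
... | true = ≤-trans (Σ-∖ g l z) (m≤n+m _ (g v))
... | false = +-monoʳ-≤ (g v) (Σ-∖ g l z)

Σ-pick : ∀ g l x → x ∈ l → g x + Σ[ g ] (l ∖ x) ≤ Σ[ g ] l
Σ-pick g (v ∷ l) x p with v ≟ x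
... | yes refl rewrite ∖-cons-≡ l v = +-monoʳ-≤ (g v) (Σ-∖ g l v)
Σ-pick g (v ∷ l) x (here refl) | no v≢v = ⊥-elim (v≢v refl)
Σ-pick g (v ∷ l) x (there p) | no v≢x rewrite ∖-cons-≢ v l x v≢x =
  ≤-trans (≤-reflexive (+-exchange (g x) (g v) _)) (+-monoʳ-≤ (g v) (Σ-pick g l x p))

-- Lower bound: a well-formed term weighs at least the sum of the weights of
-- its free variables (linear terms use each of them at least once).
Σ≤φ : ∀ M ρ → Λ®[/] M → Σ[ ρ ] (fv M) ≤ φ M ρ
Σ≤φ (var x) ρ _ = ≤-reflexive (+-identityʳ _)
Σ≤φ (lam x M) ρ (lam _ _ wM _) =
  ≤-trans (≤-reflexive (≡-sym (Σ-agree (fv M ∖ x) (agree-∖ ρ x 0 (fv M)))))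
    (≤-trans (Σ-∖ _ (fv M) x) (Σ≤φ M _ wM))
Σ≤φ (app M N) ρ (app _ _ wM wN _) =
  ≤-trans (≤-reflexive (Σ-++ ρ (fv M) (fv N))) (+-mono-≤ (Σ≤φ M ρ wM) (Σ≤φ N ρ wN))
Σ≤φ (era x M) ρ (era _ _ wM _) = +-monoʳ-≤ (ρ x) (Σ≤φ M ρ wM)
Σ≤φ (dup x x₁ x₂ M) ρ (dup _ _ _ _ wM x₁∈M _ _ _) =
  ≤-trans (+-mono-≤ (≤-reflexive (≡-sym (upd²-first ρ x₁ x₂ (ρ x))))
             (≤-trans (≤-reflexive (≡-sym (Σ-agree _ (agree-∖² ρ x₁ x₂ (ρ x) (fv M)))))
                      (Σ-∖ _ (fv M ∖ x₁) x₂)))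
    (≤-trans (Σ-pick _ (fv M) x₁ x₁∈M) (Σ≤φ M _ wM))
Σ≤φ (sub M x N) ρ (sub _ _ _ wM x∈M wN _) =
  ≤-trans (≤-reflexive (≡-trans (Σ-++ ρ (fv M ∖ x) (fv N)) (+-comm (Σ[ ρ ] (fv M ∖ x)) _)))
    (≤-trans (+-mono-≤ (≤-trans (Σ≤φ N ρ (fromΛ® wN)) (≤-reflexive (≡-sym (upd-same ρ x (φ N ρ)))))
                       (≤-reflexive (≡-sym (Σ-agree (fv M ∖ x) (agree-∖ ρ x (φ N ρ) (fv M))))))
      (≤-trans (Σ-pick _ (fv M) x x∈M) (Σ≤φ M _ wM)))

Σ⁺≤⟦⟧ : ∀ M ρ → Σ[ ρ ⁺ ] (fv M) ≤ ⟦ M ⟧ ρ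
Σ⁺≤⟦⟧ (var x) ρ = ≤-reflexive (+-identityʳ _)
Σ⁺≤⟦⟧ (lam x M) ρ =
  ≤-trans (≤-reflexive (≡-sym (Σ⁺-agree (fv M ∖ x) (agree-∖ ρ x 0 (fv M)))))
    (≤-trans (Σ-∖ _ (fv M) x) (≤-trans (Σ⁺≤⟦⟧ M _) (m≤n+m _ _)))
Σ⁺≤⟦⟧ (app M N) ρ =
  ≤-trans (≤-reflexive (Σ-++ (ρ ⁺) (fv M) (fv N)))
    (≤-trans (+-mono-≤ (Σ⁺≤⟦⟧ M ρ) (Σ⁺≤⟦⟧ N ρ)) (m≤n+m _ (suc (φ M ρ + φ N ρ))))
Σ⁺≤⟦⟧ (era x M) ρ = +-mono-≤ (m≤m*n (suc (ρ x)) (suc (ρ x + φ M ρ))) (Σ⁺≤⟦⟧ M ρ)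
Σ⁺≤⟦⟧ (dup x x₁ x₂ M) ρ =
  +-mono-≤ (m≤m*n (suc (ρ x)) _)
    (≤-trans (≤-reflexive (≡-sym (Σ⁺-agree _ (agree-∖² ρ x₁ x₂ (ρ x) (fv M)))))
      (≤-trans (Σ-∖ _ (fv M ∖ x₁) x₂) (≤-trans (Σ-∖ _ (fv M) x₁) (Σ⁺≤⟦⟧ M _))))
Σ⁺≤⟦⟧ (sub M x N) ρ =
  ≤-trans (≤-reflexive (≡-trans (Σ-++ (ρ ⁺) (fv M ∖ x) (fv N)) (+-comm (Σ[ ρ ⁺ ] (fv M ∖ x)) _)))
    (+-mono-≤ (≤-trans (Σ⁺≤⟦⟧ N ρ) (m≤n+m (⟦ N ⟧ ρ) _)) bodyBound)
  where
  bodyBound : Σ[ ρ ⁺ ] (fv M ∖ x) ≤ ⟦ M ⟧ (ρ [ x ≔ Wt (⟦ N ⟧ ρ) ])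
  bodyBound = ≤-trans (≤-reflexive (≡-sym (Σ⁺-agree (fv M ∖ x) (agree-∖ ρ x _ (fv M)))))
                (≤-trans (Σ-∖ _ (fv M) x) (Σ⁺≤⟦⟧ M _))

fv⊆vars : ∀ M {z} → z ∈ fv M → z ∈ vars M
fv⊆vars (var x) p = p
fv⊆vars (lam x M) p = there (fv⊆vars M (proj₁ (∈-∖⁻ (fv M) p)))
fv⊆vars (app M N) p with ∈-++⁻ (fv M) p
... | inj₁ q = ∈-++⁺ˡ (fv⊆vars M q)
... | inj₂ q = ∈-++⁺ʳ (vars M) (fv⊆vars N q)
fv⊆vars (era x M) (here p) = here p
fv⊆vars (era x M) (there p) = there (fv⊆vars M p)
fv⊆vars (dup x x₁ x₂ M) (here p) = here p
fv⊆vars (dup x x₁ x₂ M) (there p) =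
  there (there (there (fv⊆vars M (proj₁ (∈-∖⁻ (fv M) (proj₁ (∈-∖⁻ (fv M ∖ x₁) p)))))))
fv⊆vars (sub M x N) p with ∈-++⁻ (fv M ∖ x) p
... | inj₁ q = there (∈-++⁺ˡ (fv⊆vars M (proj₁ (∈-∖⁻ (fv M) q))))
... | inj₂ q = there (∈-++⁺ʳ (vars M) (fv⊆vars N q))

∉vars⇒∉fv : ∀ M {y} → y ∉ vars M → y ∉ fv M
∉vars⇒∉fv M y∉ = y∉ ∘ fv⊆vars M

rn : Var → Var → Var → Var
rn x y z = if z ≡ᵇ x then y else z

rn-weight : ∀ ρ x y z → ρ (rn x y z) ≡ (ρ [ x ≔ ρ y ]) z
rn-weight ρ x y z with z ≡ᵇ x
... | true = refl
... | false = refl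

RenamingLaw : (Term → Env → ℕ) → Set
RenamingLaw F = ∀ M x y ρ → y ∉ vars M → F (ren x y M) ρ ≡ F M (ρ [ x ≔ ρ y ])

∉-head : ∀ {y z} {l : List Var} → y ∉ z ∷ l → y ≢ z
∉-head y∉ y≡z = y∉ (here y≡z)

∉-tail : ∀ {y z} {l : List Var} → y ∉ z ∷ l → y ∉ l
∉-tail y∉ = y∉ ∘ there

∉-++ˡ : ∀ {y} (l k : List Var) → y ∉ l ++ k → y ∉ l
∉-++ˡ l k y∉ = y∉ ∘ ∈-++⁺ˡ

∉-++ʳ : ∀ {y} (l k : List Var) → y ∉ l ++ k → y ∉ k
∉-++ʳ l k y∉ = y∉ ∘ ∈-++⁺ʳ l

renamed-body : ∀ F → DependsOnFv F → ∀ M x y z ρ c → y ≢ z →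
  (∀ σ → F (ren x y M) σ ≡ F M (σ [ x ≔ σ y ])) →
  F (if z ≡ᵇ x then M else ren x y M) (ρ [ z ≔ c ]) ≡ F M (ρ [ x ≔ ρ y ] [ z ≔ c ])
renamed-body F F-fv M x y z ρ c y≢z ih with z ≡ᵇ x in e
... | true rewrite ≡ᵇ-true⇒≡ z x e = respects-≐ F F-fv M (≐-sym (upd-shadow ρ x (ρ y) c))
... | false = begin
  F (ren x y M) (ρ [ z ≔ c ])                          ≡⟨ ih _ ⟩
  F M (ρ [ z ≔ c ] [ x ≔ (ρ [ z ≔ c ]) y ])            ≡⟨ cong (λ d → F M (ρ [ z ≔ c ] [ x ≔ d ])) (upd-other ρ z c y y≢z) ⟩
  F M (ρ [ z ≔ c ] [ x ≔ ρ y ])                        ≡⟨ respects-≐ F F-fv M (upd-comm ρ x z c (ρ y) (≢-sym (≡ᵇ-false⇒≢ z x e))) ⟩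
  F M (ρ [ x ≔ ρ y ] [ z ≔ c ])                        ∎
  where open ≡-Reasoning

renamed-dup-body : ∀ F → DependsOnFv F → ∀ M x y z₁ z₂ ρ a → y ≢ z₁ → y ≢ z₂ →
  (∀ σ → F (ren x y M) σ ≡ F M (σ [ x ≔ σ y ])) →
  F (if z₁ ≡ᵇ x then M else if z₂ ≡ᵇ x then M else ren x y M) (ρ [ z₁ ≔ a ] [ z₂ ≔ a ])
    ≡ F M (ρ [ x ≔ ρ y ] [ z₁ ≔ a ] [ z₂ ≔ a ])
renamed-dup-body F F-fv M x y z₁ z₂ ρ a y≢z₁ y≢z₂ ih with z₁ ≡ᵇ x in e₁
... | true rewrite ≡ᵇ-true⇒≡ z₁ x e₁ =
  respects-≐ F F-fv M (upd-cong _ _ z₂ a (≐-sym (upd-shadow ρ x (ρ y) a)))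
... | false = ≡-trans (renamed-body F F-fv M x y z₂ (ρ [ z₁ ≔ a ]) a y≢z₂ ih)
                (≡-trans (cong (λ d → F M (ρ [ z₁ ≔ a ] [ x ≔ d ] [ z₂ ≔ a ])) (upd-other ρ z₁ a y y≢z₁))
                   (respects-≐ F F-fv M (upd-cong _ _ z₂ a (upd-comm ρ x z₁ a (ρ y) (≢-sym (≡ᵇ-false⇒≢ z₁ x e₁))))))

ren-φ : RenamingLaw φ
ren-φ (var z) x y ρ _ = rn-weight ρ x y z
ren-φ (lam z M) x y ρ y∉ =
  renamed-body φ φ-fv M x y z ρ 0 (∉-head y∉) (λ σ → ren-φ M x y σ (∉-tail y∉))
ren-φ (app M N) x y ρ y∉ =
  cong₂ _+_ (ren-φ M x y ρ (∉-++ˡ (vars M) (vars N) y∉)) (ren-φ N x y ρ (∉-++ʳ (vars M) (vars N) y∉))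
ren-φ (era z M) x y ρ y∉ = cong₂ _+_ (rn-weight ρ x y z) (ren-φ M x y ρ (∉-tail y∉))
ren-φ (dup z z₁ z₂ M) x y ρ y∉ rewrite rn-weight ρ x y z =
  renamed-dup-body φ φ-fv M x y z₁ z₂ ρ _ (∉-head (∉-tail y∉)) (∉-head (∉-tail (∉-tail y∉)))
    (λ σ → ren-φ M x y σ (∉-tail (∉-tail (∉-tail y∉))))
ren-φ (sub M z N) x y ρ y∉ rewrite ren-φ N x y ρ (∉-++ʳ (vars M) (vars N) (∉-tail y∉)) =
  renamed-body φ φ-fv M x y z ρ _ (∉-head y∉) (λ σ → ren-φ M x y σ (∉-++ˡ (vars M) (vars N) (∉-tail y∉)))

ren-⟦⟧ : RenamingLaw ⟦_⟧
ren-⟦⟧ (var z) x y ρ _ = cong suc (rn-weight ρ x y z)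
ren-⟦⟧ (lam z M) x y ρ y∉ =
  cong₂ (λ a b → suc a + b)
    (renamed-body φ φ-fv M x y z ρ 0 (∉-head y∉) (λ σ → ren-φ M x y σ (∉-tail y∉)))
    (renamed-body ⟦_⟧ ⟦⟧-fv M x y z ρ 0 (∉-head y∉) (λ σ → ren-⟦⟧ M x y σ (∉-tail y∉)))
ren-⟦⟧ (app M N) x y ρ y∉ =
  cong₂ (λ a b → suc a + b) (cong₂ _+_ (ren-φ M x y ρ y∉M) (ren-φ N x y ρ y∉N))
                            (cong₂ _+_ (ren-⟦⟧ M x y ρ y∉M) (ren-⟦⟧ N x y ρ y∉N))
  where
  y∉M : y ∉ vars M
  y∉M = ∉-++ˡ (vars M) (vars N) y∉
  y∉N : y ∉ vars N
  y∉N = ∉-++ʳ (vars M) (vars N) y∉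
ren-⟦⟧ (era z M) x y ρ y∉ rewrite rn-weight ρ x y z | ren-φ M x y ρ (∉-tail y∉) =
  cong (suc ((ρ [ x ≔ ρ y ]) z) * suc ((ρ [ x ≔ ρ y ]) z + φ M (ρ [ x ≔ ρ y ])) +_)
       (ren-⟦⟧ M x y ρ (∉-tail y∉))
ren-⟦⟧ (dup z z₁ z₂ M) x y ρ y∉ rewrite rn-weight ρ x y z =
  cong₂ (λ a b → suc ((ρ [ x ≔ ρ y ]) z) * suc a + b)
    (renamed-dup-body φ φ-fv M x y z₁ z₂ ρ _ y≢z₁ y≢z₂ (λ σ → ren-φ M x y σ y∉M))
    (renamed-dup-body ⟦_⟧ ⟦⟧-fv M x y z₁ z₂ ρ _ y≢z₁ y≢z₂ (λ σ → ren-⟦⟧ M x y σ y∉M))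
  where
  y≢z₁ : y ≢ z₁
  y≢z₁ = ∉-head (∉-tail y∉)
  y≢z₂ : y ≢ z₂
  y≢z₂ = ∉-head (∉-tail (∉-tail y∉))
  y∉M : y ∉ vars M
  y∉M = ∉-tail (∉-tail (∉-tail y∉))
ren-⟦⟧ (sub M z N) x y ρ y∉
  rewrite ren-φ N x y ρ (∉-++ʳ (vars M) (vars N) (∉-tail y∉))
        | ren-⟦⟧ N x y ρ (∉-++ʳ (vars M) (vars N) (∉-tail y∉)) =
  cong₂ (λ a b → suc a + ⟦ N ⟧ (ρ [ x ≔ ρ y ]) + b)
    (renamed-body φ φ-fv M x y z ρ _ (∉-head y∉) (λ σ → ren-φ M x y σ y∉M))
    (renamed-body ⟦_⟧ ⟦⟧-fv M x y z ρ _ (∉-head y∉) (λ σ → ren-⟦⟧ M x y σ y∉M))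
  where
  y∉M : y ∉ vars M
  y∉M = ∉-++ˡ (vars M) (vars N) (∉-tail y∉)

rename-bound : ∀ F → DependsOnFv F → RenamingLaw F →
  ∀ M x y ρ c → y ∉ vars M → F (ren x y M) (ρ [ y ≔ c ]) ≡ F M (ρ [ x ≔ c ])
rename-bound F F-fv F-ren M x y ρ c y∉ = begin
  F (ren x y M) (ρ [ y ≔ c ])                ≡⟨ F-ren M x y _ y∉ ⟩
  F M (ρ [ y ≔ c ] [ x ≔ (ρ [ y ≔ c ]) y ])  ≡⟨ cong (λ d → F M (ρ [ y ≔ c ] [ x ≔ d ])) (upd-same ρ y c) ⟩
  F M (ρ [ y ≔ c ] [ x ≔ c ])                ≡⟨ F-fv M _ _ (agree-bind (fv M) _ _ x c (agree-fresh ρ y c _ y∉M∖x)) ⟩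
  F M (ρ [ x ≔ c ])                          ∎
  where
  open ≡-Reasoning
  y∉M∖x : y ∉ fv M ∖ x
  y∉M∖x = ∉vars⇒∉fv M y∉ ∘ proj₁ ∘ ∈-∖⁻ (fv M)

rename-bound₁ : ∀ F → DependsOnFv F → RenamingLaw F →
  ∀ M x₁ x₂ y ρ a → y ∉ vars M →
  F (ren x₁ y M) (ρ [ y ≔ a ] [ x₂ ≔ a ]) ≡ F M (ρ [ x₁ ≔ a ] [ x₂ ≔ a ])
rename-bound₁ F F-fv F-ren M x₁ x₂ y ρ a y∉ =
  ≡-trans (respects-≐ F F-fv (ren x₁ y M) (upd-swap ρ y x₂ a))
    (≡-trans (rename-bound F F-fv F-ren M x₁ y (ρ [ x₂ ≔ a ]) a y∉)
       (respects-≐ F F-fv M (upd-swap ρ x₂ x₁ a)))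

_≃_ : Term → Term → Set
M ≃ N = ∀ ρ → φ M ρ ≡ φ N ρ × ⟦ M ⟧ ρ ≡ ⟦ N ⟧ ρ

α₀-≃ : ∀ {M N} → M ~α₀ N → M ≃ N
α₀-≃ (lam x y M y∉) ρ =
  ≡-sym eφ , cong₂ (λ a b → suc a + b) (≡-sym eφ) (≡-sym (rename-bound ⟦_⟧ ⟦⟧-fv ren-⟦⟧ M x y ρ 0 y∉))
  where
  eφ : φ (ren x y M) (ρ [ y ≔ 0 ]) ≡ φ M (ρ [ x ≔ 0 ])
  eφ = rename-bound φ φ-fv ren-φ M x y ρ 0 y∉
α₀-≃ (dup₁ z x₁ x₂ y M y∉) ρ =
  ≡-sym eφ , cong₂ (λ a b → suc (ρ z) * suc a + b) (≡-sym eφ)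
                   (≡-sym (rename-bound₁ ⟦_⟧ ⟦⟧-fv ren-⟦⟧ M x₁ x₂ y ρ (ρ z) y∉))
  where
  eφ : φ (ren x₁ y M) (ρ [ y ≔ ρ z ] [ x₂ ≔ ρ z ]) ≡ φ M (ρ [ x₁ ≔ ρ z ] [ x₂ ≔ ρ z ])
  eφ = rename-bound₁ φ φ-fv ren-φ M x₁ x₂ y ρ (ρ z) y∉
α₀-≃ (dup₂ z x₁ x₂ y M y∉) ρ =
  ≡-sym eφ , cong₂ (λ a b → suc (ρ z) * suc a + b) (≡-sym eφ)
                   (≡-sym (rename-bound ⟦_⟧ ⟦⟧-fv ren-⟦⟧ M x₂ y (ρ [ x₁ ≔ ρ z ]) (ρ z) y∉))
  where
  eφ : φ (ren x₂ y M) (ρ [ x₁ ≔ ρ z ] [ y ≔ ρ z ]) ≡ φ M (ρ [ x₁ ≔ ρ z ] [ x₂ ≔ ρ z ])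
  eφ = rename-bound φ φ-fv ren-φ M x₂ y (ρ [ x₁ ≔ ρ z ]) (ρ z) y∉
α₀-≃ (sub M x N y y∉) ρ =
  ≡-sym eφ , cong₂ (λ a b → suc a + ⟦ N ⟧ ρ + b) (≡-sym eφ)
                   (≡-sym (rename-bound ⟦_⟧ ⟦⟧-fv ren-⟦⟧ M x y ρ (Wt (⟦ N ⟧ ρ)) y∉))
  where
  eφ : φ (ren x y M) (ρ [ y ≔ φ N ρ ]) ≡ φ M (ρ [ x ≔ φ N ρ ])
  eφ = rename-bound φ φ-fv ren-φ M x y ρ (φ N ρ) y∉

α-≃ : ∀ {M N} → M ≡α N → M ≃ N
α-≃ (base b) ρ = α₀-≃ b ρ
α-≃ refl ρ = refl , refl
α-≃ (sym a) ρ = let (eφ , e⟦⟧) = α-≃ a ρ in ≡-sym eφ , ≡-sym e⟦⟧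
α-≃ (trans a b) ρ =
  let (eφ₁ , e⟦⟧₁) = α-≃ a ρ ; (eφ₂ , e⟦⟧₂) = α-≃ b ρ in ≡-trans eφ₁ eφ₂ , ≡-trans e⟦⟧₁ e⟦⟧₂
α-≃ (lam x a) ρ = let (eφ , e⟦⟧) = α-≃ a _ in eφ , cong₂ (λ u v → suc u + v) eφ e⟦⟧
α-≃ (app a b) ρ =
  let (eφ₁ , e⟦⟧₁) = α-≃ a ρ ; (eφ₂ , e⟦⟧₂) = α-≃ b ρ
  in cong₂ _+_ eφ₁ eφ₂ , cong₂ (λ u v → suc u + v) (cong₂ _+_ eφ₁ eφ₂) (cong₂ _+_ e⟦⟧₁ e⟦⟧₂)
α-≃ (era x a) ρ =
  let (eφ , e⟦⟧) = α-≃ a ρ in cong (ρ x +_) eφ , cong₂ (λ u v → suc (ρ x) * suc (ρ x + u) + v) eφ e⟦⟧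
α-≃ (dup x x₁ x₂ a) ρ =
  let (eφ , e⟦⟧) = α-≃ a _ in eφ , cong₂ (λ u v → suc (ρ x) * suc u + v) eφ e⟦⟧
α-≃ (sub x {N' = N'} a b) ρ with α-≃ b ρ
... | eφN , e⟦N⟧ rewrite eφN | e⟦N⟧ =
  proj₁ (α-≃ a _) , cong₂ (λ u v → suc u + ⟦ N' ⟧ ρ + v) (proj₁ (α-≃ a _)) (proj₂ (α-≃ a _))

rn-x : ∀ x y → rn x y x ≡ y
rn-x x y rewrite ≡ᵇ-refl x = refl

rn-other : ∀ x y w → w ≢ x → rn x y w ≡ w
rn-other x y w w≢x rewrite ≢⇒≡ᵇ-false w x w≢x = refl

rn-injective : ∀ x y w₁ w₂ → w₁ ≢ y → w₂ ≢ y → rn x y w₁ ≡ rn x y w₂ → w₁ ≡ w₂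
rn-injective x y w₁ w₂ w₁≢y w₂≢y e with w₁ ≡ᵇ x in e₁ | w₂ ≡ᵇ x in e₂
... | true | true = ≡-trans (≡ᵇ-true⇒≡ w₁ x e₁) (≡-sym (≡ᵇ-true⇒≡ w₂ x e₂))
... | true | false = ⊥-elim (w₂≢y (≡-sym e))
... | false | true = ⊥-elim (w₁≢y e)
... | false | false = e

map-rn-∖ : ∀ l x y z → z ≢ x → z ≢ y → map (rn x y) (l ∖ z) ≡ map (rn x y) l ∖ z
map-rn-∖ [] x y z z≢x z≢y = refl
map-rn-∖ (w ∷ l) x y z z≢x z≢y with w ≟ x
... | yes refl
  rewrite ∖-cons-≢ w l z (≢-sym z≢x) | rn-x w y | ∖-cons-≢ y (map (rn w y) l) z (≢-sym z≢y) =
  cong (y ∷_) (map-rn-∖ l w y z z≢x z≢y)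
... | no w≢x rewrite rn-other x y w w≢x with w ≟ z
...   | yes refl rewrite ∖-cons-≡ l w | ∖-cons-≡ (map (rn x y) l) w = map-rn-∖ l x y w z≢x z≢y
...   | no w≢z rewrite ∖-cons-≢ w l z w≢z | ∖-cons-≢ w (map (rn x y) l) z w≢z | rn-other x y w w≢x =
  cong (w ∷_) (map-rn-∖ l x y z z≢x z≢y)

map-rn-∖² : ∀ l x y z₁ z₂ → z₁ ≢ x → z₁ ≢ y → z₂ ≢ x → z₂ ≢ y →
            map (rn x y) ((l ∖ z₁) ∖ z₂) ≡ (map (rn x y) l ∖ z₁) ∖ z₂
map-rn-∖² l x y z₁ z₂ z₁≢x z₁≢y z₂≢x z₂≢y =
  ≡-trans (map-rn-∖ (l ∖ z₁) x y z₂ z₂≢x z₂≢y) (cong (_∖ z₂) (map-rn-∖ l x y z₁ z₁≢x z₁≢y))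

map-rn-id : ∀ l x y → x ∉ l → map (rn x y) l ≡ l
map-rn-id [] x y x∉l = refl
map-rn-id (w ∷ l) x y x∉l =
  cong₂ _∷_ (rn-other x y w (≢-sym (∉-head x∉l))) (map-rn-id l x y (∉-tail x∉l))

∉-∖∖-self₁ : ∀ l x z → x ∉ (l ∖ x) ∖ z
∉-∖∖-self₁ l x z = ∉-∖-self l x ∘ proj₁ ∘ ∈-∖⁻ (l ∖ x)

∉-∖∖-self₂ : ∀ l x z → x ∉ (l ∖ z) ∖ x
∉-∖∖-self₂ l x z = ∉-∖-self (l ∖ z) x

fv-ren : ∀ M x y → y ∉ vars M → fv (ren x y M) ≡ map (rn x y) (fv M)
fv-ren (var z) x y _ = refl
fv-ren (lam z M) x y y∉ with z ≡ᵇ x in e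
... | true rewrite ≡ᵇ-true⇒≡ z x e = ≡-sym (map-rn-id (fv M ∖ x) x y (∉-∖-self (fv M) x))
... | false rewrite fv-ren M x y (∉-tail y∉) =
  ≡-sym (map-rn-∖ (fv M) x y z (≡ᵇ-false⇒≢ z x e) (≢-sym (∉-head y∉)))
fv-ren (app M N) x y y∉
  rewrite fv-ren M x y (∉-++ˡ (vars M) (vars N) y∉) | fv-ren N x y (∉-++ʳ (vars M) (vars N) y∉) =
  ≡-sym (map-++ (rn x y) (fv M) (fv N))
fv-ren (era z M) x y y∉ = cong (rn x y z ∷_) (fv-ren M x y (∉-tail y∉))
fv-ren (dup z z₁ z₂ M) x y y∉ with z₁ ≡ᵇ x in e₁
... | true rewrite ≡ᵇ-true⇒≡ z₁ x e₁ =
  cong (rn x y z ∷_) (≡-sym (map-rn-id _ x y (∉-∖∖-self₁ (fv M) x z₂)))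
... | false with z₂ ≡ᵇ x in e₂
... | true rewrite ≡ᵇ-true⇒≡ z₂ x e₂ =
  cong (rn x y z ∷_) (≡-sym (map-rn-id _ x y (∉-∖∖-self₂ (fv M) x z₁)))
... | false rewrite fv-ren M x y (∉-tail (∉-tail (∉-tail y∉))) =
  cong (rn x y z ∷_)
    (≡-sym (map-rn-∖² (fv M) x y z₁ z₂ (≡ᵇ-false⇒≢ z₁ x e₁) (≢-sym (∉-head (∉-tail y∉)))
                                      (≡ᵇ-false⇒≢ z₂ x e₂) (≢-sym (∉-head (∉-tail (∉-tail y∉))))))
fv-ren (sub M z N) x y y∉ with z ≡ᵇ x in e
... | true rewrite ≡ᵇ-true⇒≡ z x e | fv-ren N x y (∉-++ʳ (vars M) (vars N) (∉-tail y∉))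
                 | map-++ (rn x y) (fv M ∖ x) (fv N) | map-rn-id (fv M ∖ x) x y (∉-∖-self (fv M) x) = refl
... | false rewrite fv-ren N x y (∉-++ʳ (vars M) (vars N) (∉-tail y∉))
                  | fv-ren M x y (∉-++ˡ (vars M) (vars N) (∉-tail y∉))
                  | map-++ (rn x y) (fv M ∖ z) (fv N)
                  | map-rn-∖ (fv M) x y z (≡ᵇ-false⇒≢ z x e) (≢-sym (∉-head y∉)) = refl

∈⇒≢ : ∀ {y w} {l : List Var} → y ∉ l → w ∈ l → w ≢ y
∈⇒≢ y∉l w∈l refl = y∉l w∈l

∉-∖ : ∀ {y} l x → y ∉ l → y ∉ l ∖ x
∉-∖ l x y∉l = y∉l ∘ proj₁ ∘ ∈-∖⁻ l

∈-map-rn⁺ : ∀ x y l {z} → z ≢ x → z ∈ l → z ∈ map (rn x y) l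
∈-map-rn⁺ x y l {z} z≢x p = subst (_∈ map (rn x y) l) (rn-other x y z z≢x) (∈-map⁺ (rn x y) p)

∈-map-rn-rn⁻ : ∀ x y l {z} → y ∉ l → z ≢ y → rn x y z ∈ map (rn x y) l → z ∈ l
∈-map-rn-rn⁻ x y l {z} y∉l z≢y p with ∈-map⁻ (rn x y) p
... | w , w∈l , e = subst (_∈ l) (≡-sym (rn-injective x y z w z≢y (∈⇒≢ y∉l w∈l) e)) w∈l

∈-map-rn⁻ : ∀ x y l {z} → y ∉ l → z ≢ y → z ≢ x → z ∈ map (rn x y) l → z ∈ l
∈-map-rn⁻ x y l {z} y∉l z≢y z≢x p =
  ∈-map-rn-rn⁻ x y l y∉l z≢y (subst (_∈ map (rn x y) l) (≡-sym (rn-other x y z z≢x)) p)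

∉-map-rn⁺ : ∀ x y l {z} → y ∉ l → z ≢ y → z ∉ l → rn x y z ∉ map (rn x y) l
∉-map-rn⁺ x y l y∉l z≢y z∉l = z∉l ∘ ∈-map-rn-rn⁻ x y l y∉l z≢y

∉-map-rn⁻ : ∀ x y l {z} → rn x y z ∉ map (rn x y) l → z ∉ l
∉-map-rn⁻ x y l h = h ∘ ∈-map⁺ (rn x y)

Disjoint-map-rn⁺ : ∀ x y A B → y ∉ A → y ∉ B → Disjoint A B →
                   Disjoint (map (rn x y) A) (map (rn x y) B)
Disjoint-map-rn⁺ x y A B y∉A y∉B d p q with ∈-map⁻ (rn x y) p
... | w , w∈A , refl = d w∈A (∈-map-rn-rn⁻ x y B y∉B (∈⇒≢ y∉A w∈A) q)

Disjoint-map-rn⁻ : ∀ x y A B → Disjoint (map (rn x y) A) (map (rn x y) B) → Disjoint A B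
Disjoint-map-rn⁻ x y A B d p q = d (∈-map⁺ (rn x y) p) (∈-map⁺ (rn x y) q)

rn-∉ : ∀ x y z l → y ∉ l → z ∉ l → rn x y z ∉ l
rn-∉ x y z l y∉l z∉l with z ≡ᵇ x
... | true = y∉l
... | false = z∉l

rn-∉⁻ : ∀ x y z l → x ∉ l → rn x y z ∉ l → z ∉ l
rn-∉⁻ x y z l x∉l h with z ≡ᵇ x in e
... | true = subst (_∉ l) (≡-sym (≡ᵇ-true⇒≡ z x e)) x∉l
... | false = h

SubFree-ren⁺ : ∀ M x y → SubFree M → SubFree (ren x y M)
SubFree-ren⁺ (var z) x y sf = tt
SubFree-ren⁺ (lam z M) x y sf with z ≡ᵇ x
... | true = sf
... | false = SubFree-ren⁺ M x y sf
SubFree-ren⁺ (app M N) x y (sfM , sfN) = SubFree-ren⁺ M x y sfM , SubFree-ren⁺ N x y sfN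
SubFree-ren⁺ (era z M) x y sf = SubFree-ren⁺ M x y sf
SubFree-ren⁺ (dup z z₁ z₂ M) x y sf with z₁ ≡ᵇ x
... | true = sf
... | false with z₂ ≡ᵇ x
... | true = sf
... | false = SubFree-ren⁺ M x y sf

SubFree-ren⁻ : ∀ M x y → SubFree (ren x y M) → SubFree M
SubFree-ren⁻ (var z) x y sf = tt
SubFree-ren⁻ (lam z M) x y sf with z ≡ᵇ x
... | true = sf
... | false = SubFree-ren⁻ M x y sf
SubFree-ren⁻ (app M N) x y (sfM , sfN) = SubFree-ren⁻ M x y sfM , SubFree-ren⁻ N x y sfN
SubFree-ren⁻ (era z M) x y sf = SubFree-ren⁻ M x y sf
SubFree-ren⁻ (dup z z₁ z₂ M) x y sf with z₁ ≡ᵇ x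
... | true = sf
... | false with z₂ ≡ᵇ x
... | true = sf
... | false = SubFree-ren⁻ M x y sf
SubFree-ren⁻ (sub M z N) x y sf with z ≡ᵇ x
... | true = sf
... | false = sf

Λ®[/]-ren⁺-dup : ∀ z z₁ z₂ M x y → y ∉ vars (dup z z₁ z₂ M) → (Λ®[/] M → Λ®[/] (ren x y M)) →
                 Λ®[/] (dup z z₁ z₂ M) → Λ®[/] (ren x y (dup z z₁ z₂ M))
Λ®[/]-ren⁺-dup z z₁ z₂ M x y y∉ ih (dup _ _ _ _ wM z₁∈M z₂∈M z₁≢z₂ z∉) with z₁ ≡ᵇ x in e₁
... | true = dup _ z₁ z₂ M wM z₁∈M z₂∈M z₁≢z₂ (rn-∉ x y z _ y∉body z∉)
  where
  y∉body : y ∉ (fv M ∖ z₁) ∖ z₂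
  y∉body = ∉-∖ _ z₂ (∉-∖ (fv M) z₁ (∉vars⇒∉fv M (∉-tail (∉-tail (∉-tail y∉)))))
... | false with z₂ ≡ᵇ x in e₂
... | true = dup _ z₁ z₂ M wM z₁∈M z₂∈M z₁≢z₂ (rn-∉ x y z _ y∉body z∉)
  where
  y∉body : y ∉ (fv M ∖ z₁) ∖ z₂
  y∉body = ∉-∖ _ z₂ (∉-∖ (fv M) z₁ (∉vars⇒∉fv M (∉-tail (∉-tail (∉-tail y∉)))))
... | false =
  dup _ z₁ z₂ (ren x y M) (ih wM)
    (subst (z₁ ∈_) (≡-sym fvM) (∈-map-rn⁺ x y (fv M) z₁≢x z₁∈M))
    (subst (z₂ ∈_) (≡-sym fvM) (∈-map-rn⁺ x y (fv M) z₂≢x z₂∈M))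
    z₁≢z₂
    (subst (rn x y z ∉_)
       (≡-trans (map-rn-∖² (fv M) x y z₁ z₂ z₁≢x z₁≢y z₂≢x z₂≢y) (cong (λ L → (L ∖ z₁) ∖ z₂) (≡-sym fvM)))
       (∉-map-rn⁺ x y _ (∉-∖ _ z₂ (∉-∖ (fv M) z₁ (∉vars⇒∉fv M y∉M))) (≢-sym (∉-head y∉)) z∉))
  where
  y∉M : y ∉ vars M
  y∉M = ∉-tail (∉-tail (∉-tail y∉))
  fvM : fv (ren x y M) ≡ map (rn x y) (fv M)
  fvM = fv-ren M x y y∉M
  z₁≢x : z₁ ≢ x
  z₁≢x = ≡ᵇ-false⇒≢ z₁ x e₁
  z₂≢x : z₂ ≢ x
  z₂≢x = ≡ᵇ-false⇒≢ z₂ x e₂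
  z₁≢y : z₁ ≢ y
  z₁≢y = ≢-sym (∉-head (∉-tail y∉))
  z₂≢y : z₂ ≢ y
  z₂≢y = ≢-sym (∉-head (∉-tail (∉-tail y∉)))

Λ®[/]-ren⁻-dup : ∀ z z₁ z₂ M x y → y ∉ vars (dup z z₁ z₂ M) → (Λ®[/] (ren x y M) → Λ®[/] M) →
                 Λ®[/] (ren x y (dup z z₁ z₂ M)) → Λ®[/] (dup z z₁ z₂ M)
Λ®[/]-ren⁻-dup z z₁ z₂ M x y y∉ ih w with z₁ ≡ᵇ x in e₁
Λ®[/]-ren⁻-dup z z₁ z₂ M x y y∉ ih (dup _ _ _ _ wM z₁∈M z₂∈M z₁≢z₂ z∉) | true =
  dup z z₁ z₂ M wM z₁∈M z₂∈M z₁≢z₂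
    (rn-∉⁻ x y z _ (subst (_∉ (fv M ∖ z₁) ∖ z₂) (≡ᵇ-true⇒≡ z₁ x e₁) (∉-∖∖-self₁ (fv M) z₁ z₂)) z∉)
... | false with z₂ ≡ᵇ x in e₂
Λ®[/]-ren⁻-dup z z₁ z₂ M x y y∉ ih (dup _ _ _ _ wM z₁∈M z₂∈M z₁≢z₂ z∉) | false | true =
  dup z z₁ z₂ M wM z₁∈M z₂∈M z₁≢z₂
    (rn-∉⁻ x y z _ (subst (_∉ (fv M ∖ z₁) ∖ z₂) (≡ᵇ-true⇒≡ z₂ x e₂) (∉-∖∖-self₂ (fv M) z₂ z₁)) z∉)
Λ®[/]-ren⁻-dup z z₁ z₂ M x y y∉ ih (dup _ _ _ _ wM z₁∈M z₂∈M z₁≢z₂ z∉) | false | false =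
  dup z z₁ z₂ M (ih wM)
    (∈-map-rn⁻ x y (fv M) y∉fvM z₁≢y z₁≢x (subst (z₁ ∈_) fvM z₁∈M))
    (∈-map-rn⁻ x y (fv M) y∉fvM z₂≢y z₂≢x (subst (z₂ ∈_) fvM z₂∈M))
    z₁≢z₂
    (∉-map-rn⁻ x y _
       (subst (rn x y z ∉_)
          (≡-trans (cong (λ L → (L ∖ z₁) ∖ z₂) fvM) (≡-sym (map-rn-∖² (fv M) x y z₁ z₂ z₁≢x z₁≢y z₂≢x z₂≢y)))
          z∉))
  where
  y∉M : y ∉ vars M
  y∉M = ∉-tail (∉-tail (∉-tail y∉))
  y∉fvM : y ∉ fv M
  y∉fvM = ∉vars⇒∉fv M y∉M
  fvM : fv (ren x y M) ≡ map (rn x y) (fv M)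
  fvM = fv-ren M x y y∉M
  z₁≢x : z₁ ≢ x
  z₁≢x = ≡ᵇ-false⇒≢ z₁ x e₁
  z₂≢x : z₂ ≢ x
  z₂≢x = ≡ᵇ-false⇒≢ z₂ x e₂
  z₁≢y : z₁ ≢ y
  z₁≢y = ≢-sym (∉-head (∉-tail y∉))
  z₂≢y : z₂ ≢ y
  z₂≢y = ≢-sym (∉-head (∉-tail (∉-tail y∉)))

-- The statement itself; for the substituted term, which lies in Λ®, it is
-- transferred through SubFree (renaming creates no substitutions).
Λ®[/]-ren⁺ : ∀ M x y → y ∉ vars M → Λ®[/] M → Λ®[/] (ren x y M)

Λ®-ren⁺ : ∀ N x y → y ∉ vars N → Λ® N → Λ® (ren x y N)
Λ®-ren⁺ N x y y∉ n = toΛ® (Λ®[/]-ren⁺ N x y y∉ (fromΛ® n)) (SubFree-ren⁺ N x y (Λ®⇒SubFree n))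

Λ®[/]-ren⁺ (var z) x y _ _ = var _
Λ®[/]-ren⁺ (lam z M) x y y∉ (lam _ _ wM z∈M) with z ≡ᵇ x in e
... | true = lam z M wM z∈M
... | false = lam z (ren x y M) (Λ®[/]-ren⁺ M x y y∉M wM)
                (subst (z ∈_) (≡-sym (fv-ren M x y y∉M)) (∈-map-rn⁺ x y (fv M) (≡ᵇ-false⇒≢ z x e) z∈M))
  where
  y∉M : y ∉ vars M
  y∉M = ∉-tail y∉
Λ®[/]-ren⁺ (app M N) x y y∉ (app _ _ wM wN d) =
  app _ _ (Λ®[/]-ren⁺ M x y y∉M wM) (Λ®[/]-ren⁺ N x y y∉N wN)
    (subst₂ Disjoint (≡-sym (fv-ren M x y y∉M)) (≡-sym (fv-ren N x y y∉N))
       (Disjoint-map-rn⁺ x y (fv M) (fv N) (∉vars⇒∉fv M y∉M) (∉vars⇒∉fv N y∉N) d))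
  where
  y∉M : y ∉ vars M
  y∉M = ∉-++ˡ (vars M) (vars N) y∉
  y∉N : y ∉ vars N
  y∉N = ∉-++ʳ (vars M) (vars N) y∉
Λ®[/]-ren⁺ (era z M) x y y∉ (era _ _ wM z∉M) =
  era _ _ (Λ®[/]-ren⁺ M x y y∉M wM)
    (subst (rn x y z ∉_) (≡-sym (fv-ren M x y y∉M))
       (∉-map-rn⁺ x y (fv M) (∉vars⇒∉fv M y∉M) (≢-sym (∉-head y∉)) z∉M))
  where
  y∉M : y ∉ vars M
  y∉M = ∉-tail y∉
Λ®[/]-ren⁺ (dup z z₁ z₂ M) x y y∉ = Λ®[/]-ren⁺-dup z z₁ z₂ M x y y∉ (Λ®[/]-ren⁺ M x y (∉-tail (∉-tail (∉-tail y∉))))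
Λ®[/]-ren⁺ (sub M z N) x y y∉ (sub _ _ _ wM z∈M nN d) with z ≡ᵇ x in e
... | true rewrite ≡ᵇ-true⇒≡ z x e =
  sub M x (ren x y N) wM z∈M (Λ®-ren⁺ N x y y∉N nN)
    (subst₂ Disjoint (map-rn-id (fv M ∖ x) x y (∉-∖-self (fv M) x)) (≡-sym (fv-ren N x y y∉N))
       (Disjoint-map-rn⁺ x y (fv M ∖ x) (fv N) (∉-∖ (fv M) x (∉vars⇒∉fv M y∉M)) (∉vars⇒∉fv N y∉N) d))
  where
  y∉M : y ∉ vars M
  y∉M = ∉-++ˡ (vars M) (vars N) (∉-tail y∉)
  y∉N : y ∉ vars N
  y∉N = ∉-++ʳ (vars M) (vars N) (∉-tail y∉)
... | false =
  sub (ren x y M) z (ren x y N) (Λ®[/]-ren⁺ M x y y∉M wM)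
    (subst (z ∈_) (≡-sym fvM) (∈-map-rn⁺ x y (fv M) z≢x z∈M))
    (Λ®-ren⁺ N x y y∉N nN)
    (subst₂ Disjoint
       (≡-trans (map-rn-∖ (fv M) x y z z≢x (≢-sym (∉-head y∉))) (cong (_∖ z) (≡-sym fvM)))
       (≡-sym (fv-ren N x y y∉N))
       (Disjoint-map-rn⁺ x y (fv M ∖ z) (fv N) (∉-∖ (fv M) z (∉vars⇒∉fv M y∉M)) (∉vars⇒∉fv N y∉N) d))
  where
  y∉M : y ∉ vars M
  y∉M = ∉-++ˡ (vars M) (vars N) (∉-tail y∉)
  y∉N : y ∉ vars N
  y∉N = ∉-++ʳ (vars M) (vars N) (∉-tail y∉)
  fvM : fv (ren x y M) ≡ map (rn x y) (fv M)
  fvM = fv-ren M x y y∉M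
  z≢x : z ≢ x
  z≢x = ≡ᵇ-false⇒≢ z x e

Λ®[/]-ren⁻ : ∀ M x y → y ∉ vars M → Λ®[/] (ren x y M) → Λ®[/] M

Λ®-ren⁻ : ∀ N x y → y ∉ vars N → Λ® (ren x y N) → Λ® N
Λ®-ren⁻ N x y y∉ n = toΛ® (Λ®[/]-ren⁻ N x y y∉ (fromΛ® n)) (SubFree-ren⁻ N x y (Λ®⇒SubFree n))

Λ®[/]-ren⁻ (var z) x y _ _ = var z
Λ®[/]-ren⁻ (lam z M) x y y∉ w with z ≡ᵇ x in e
... | true = w
Λ®[/]-ren⁻ (lam z M) x y y∉ (lam _ _ wM z∈M) | false =
  lam z M (Λ®[/]-ren⁻ M x y y∉M wM)
    (∈-map-rn⁻ x y (fv M) (∉vars⇒∉fv M y∉M) (≢-sym (∉-head y∉)) (≡ᵇ-false⇒≢ z x e)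
       (subst (z ∈_) (fv-ren M x y y∉M) z∈M))
  where
  y∉M : y ∉ vars M
  y∉M = ∉-tail y∉
Λ®[/]-ren⁻ (app M N) x y y∉ (app _ _ wM wN d) =
  app M N (Λ®[/]-ren⁻ M x y y∉M wM) (Λ®[/]-ren⁻ N x y y∉N wN)
    (Disjoint-map-rn⁻ x y (fv M) (fv N) (subst₂ Disjoint (fv-ren M x y y∉M) (fv-ren N x y y∉N) d))
  where
  y∉M : y ∉ vars M
  y∉M = ∉-++ˡ (vars M) (vars N) y∉
  y∉N : y ∉ vars N
  y∉N = ∉-++ʳ (vars M) (vars N) y∉
Λ®[/]-ren⁻ (era z M) x y y∉ (era _ _ wM z∉M) =
  era z M (Λ®[/]-ren⁻ M x y (∉-tail y∉) wM)
    (∉-map-rn⁻ x y (fv M) (subst (rn x y z ∉_) (fv-ren M x y (∉-tail y∉)) z∉M))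
Λ®[/]-ren⁻ (dup z z₁ z₂ M) x y y∉ = Λ®[/]-ren⁻-dup z z₁ z₂ M x y y∉ (Λ®[/]-ren⁻ M x y (∉-tail (∉-tail (∉-tail y∉))))
Λ®[/]-ren⁻ (sub M z N) x y y∉ w with z ≡ᵇ x in e
Λ®[/]-ren⁻ (sub M z N) x y y∉ (sub _ _ _ wM z∈M nN d) | true =
  sub M z N wM z∈M (Λ®-ren⁻ N x y y∉N nN)
    (Disjoint-map-rn⁻ x y (fv M ∖ z) (fv N)
       (subst₂ Disjoint (≡-sym (map-rn-id (fv M ∖ z) x y x∉M∖z)) (fv-ren N x y y∉N) d))
  where
  y∉N : y ∉ vars N
  y∉N = ∉-++ʳ (vars M) (vars N) (∉-tail y∉)
  x∉M∖z : x ∉ fv M ∖ z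
  x∉M∖z = subst (_∉ fv M ∖ z) (≡ᵇ-true⇒≡ z x e) (∉-∖-self (fv M) z)
Λ®[/]-ren⁻ (sub M z N) x y y∉ (sub _ _ _ wM z∈M nN d) | false =
  sub M z N (Λ®[/]-ren⁻ M x y y∉M wM)
    (∈-map-rn⁻ x y (fv M) (∉vars⇒∉fv M y∉M) z≢y z≢x (subst (z ∈_) fvM z∈M))
    (Λ®-ren⁻ N x y y∉N nN)
    (Disjoint-map-rn⁻ x y (fv M ∖ z) (fv N)
       (subst₂ Disjoint (≡-trans (cong (_∖ z) fvM) (≡-sym (map-rn-∖ (fv M) x y z z≢x z≢y)))
                        (fv-ren N x y y∉N) d))
  where
  y∉M : y ∉ vars M
  y∉M = ∉-++ˡ (vars M) (vars N) (∉-tail y∉)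
  y∉N : y ∉ vars N
  y∉N = ∉-++ʳ (vars M) (vars N) (∉-tail y∉)
  fvM : fv (ren x y M) ≡ map (rn x y) (fv M)
  fvM = fv-ren M x y y∉M
  z≢x : z ≢ x
  z≢x = ≡ᵇ-false⇒≢ z x e
  z≢y : z ≢ y
  z≢y = ≢-sym (∉-head y∉)

∖-comm : ∀ l a b → (l ∖ a) ∖ b ≡ (l ∖ b) ∖ a
∖-comm [] a b = refl
∖-comm (w ∷ l) a b with w ≡ᵇ a in e₁ | w ≡ᵇ b in e₂
... | true | true = ∖-comm l a b
... | true | false rewrite e₁ = ∖-comm l a b
... | false | true rewrite e₂ = ∖-comm l a b
... | false | false rewrite e₁ | e₂ = cong (w ∷_) (∖-comm l a b)

map-rn-∖-fresh : ∀ l x y → y ∉ l → map (rn x y) l ∖ y ≡ l ∖ x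
map-rn-∖-fresh [] x y _ = refl
map-rn-∖-fresh (w ∷ l) x y y∉ with w ≡ᵇ x
... | true rewrite ≡ᵇ-refl y = map-rn-∖-fresh l x y (∉-tail y∉)
... | false rewrite ≢⇒≡ᵇ-false w y (≢-sym (∉-head y∉)) = cong (w ∷_) (map-rn-∖-fresh l x y (∉-tail y∉))

bound-fv : ∀ M x y → y ∉ vars M → fv (ren x y M) ∖ y ≡ fv M ∖ x
bound-fv M x y y∉ =
  ≡-trans (cong (_∖ y) (fv-ren M x y y∉)) (map-rn-∖-fresh (fv M) x y (∉vars⇒∉fv M y∉))

bound-fv₂ : ∀ M x₁ x₂ y → y ∉ vars M → (fv (ren x₂ y M) ∖ x₁) ∖ y ≡ (fv M ∖ x₁) ∖ x₂
bound-fv₂ M x₁ x₂ y y∉ = begin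
  (fv (ren x₂ y M) ∖ x₁) ∖ y  ≡⟨ ∖-comm (fv (ren x₂ y M)) x₁ y ⟩
  (fv (ren x₂ y M) ∖ y) ∖ x₁  ≡⟨ cong (_∖ x₁) (bound-fv M x₂ y y∉) ⟩
  (fv M ∖ x₂) ∖ x₁            ≡⟨ ∖-comm (fv M) x₂ x₁ ⟩
  (fv M ∖ x₁) ∖ x₂            ∎
  where open ≡-Reasoning

α₀-fv : ∀ {M N} → M ~α₀ N → fv M ≡ fv N
α₀-fv (lam x y M y∉) = ≡-sym (bound-fv M x y y∉)
α₀-fv (dup₁ z x₁ x₂ y M y∉) = cong (λ l → z ∷ (l ∖ x₂)) (≡-sym (bound-fv M x₁ y y∉))
α₀-fv (dup₂ z x₁ x₂ y M y∉) = cong (z ∷_) (≡-sym (bound-fv₂ M x₁ x₂ y y∉))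
α₀-fv (sub M x N y y∉) = cong (_++ fv N) (≡-sym (bound-fv M x y y∉))

α-fv : ∀ {M N} → M ≡α N → fv M ≡ fv N
α-fv (base b) = α₀-fv b
α-fv refl = refl
α-fv (sym a) = ≡-sym (α-fv a)
α-fv (trans a b) = ≡-trans (α-fv a) (α-fv b)
α-fv (lam x a) = cong (_∖ x) (α-fv a)
α-fv (app a b) = cong₂ _++_ (α-fv a) (α-fv b)
α-fv (era x a) = cong (x ∷_) (α-fv a)
α-fv (dup x x₁ x₂ a) = cong (λ l → x ∷ ((l ∖ x₁) ∖ x₂)) (α-fv a)
α-fv (sub x a b) = cong₂ (λ l k → (l ∖ x) ++ k) (α-fv a) (α-fv b)

ren-fv⁺ : ∀ M x y → y ∉ vars M → ∀ {v} → v ∈ fv M → v ≢ x → v ∈ fv (ren x y M)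
ren-fv⁺ M x y y∉ p v≢x =
  proj₁ (∈-∖⁻ (fv (ren x y M)) (subst (_ ∈_) (≡-sym (bound-fv M x y y∉)) (∈-∖⁺ (fv M) p v≢x)))

ren-fv⁻ : ∀ M x y → y ∉ vars M → ∀ {v} → v ∈ fv (ren x y M) → v ≢ y → v ∈ fv M × v ≢ x
ren-fv⁻ M x y y∉ p v≢y = ∈-∖⁻ (fv M) (subst (_ ∈_) (bound-fv M x y y∉) (∈-∖⁺ _ p v≢y))

ren-fv-y : ∀ M x y → y ∉ vars M → x ∈ fv M → y ∈ fv (ren x y M)
ren-fv-y M x y y∉ p =
  subst (y ∈_) (≡-sym (fv-ren M x y y∉)) (subst (_∈ map (rn x y) (fv M)) (rn-x x y) (∈-map⁺ (rn x y) p))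

ren-fv-y⁻ : ∀ M x y → y ∉ vars M → y ∈ fv (ren x y M) → x ∈ fv M
ren-fv-y⁻ M x y y∉ p with ∈-map⁻ (rn x y) (subst (y ∈_) (fv-ren M x y y∉) p)
... | w , w∈M , y≡rnw with w ≟ x
...   | yes refl = w∈M
...   | no w≢x = ⊥-elim (∉vars⇒∉fv M y∉ (subst (_∈ fv M) (≡-sym (≡-trans y≡rnw (rn-other x y w w≢x))) w∈M))

α-SubFree : ∀ {M N} → M ≡α N → SubFree M ⇔ SubFree N
α-SubFree (base (lam x y M _)) = mk⇔ (SubFree-ren⁺ M x y) (SubFree-ren⁻ M x y)
α-SubFree (base (dup₁ z x₁ x₂ y M _)) = mk⇔ (SubFree-ren⁺ M x₁ y) (SubFree-ren⁻ M x₁ y)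
α-SubFree (base (dup₂ z x₁ x₂ y M _)) = mk⇔ (SubFree-ren⁺ M x₂ y) (SubFree-ren⁻ M x₂ y)
α-SubFree (base (sub M x N y _)) = mk⇔ (λ ()) (λ ())
α-SubFree refl = ⇔-id _
α-SubFree (sym a) = ⇔-sym (α-SubFree a)
α-SubFree (trans a b) = α-SubFree b ⇔-∘ α-SubFree a
α-SubFree (lam x a) = α-SubFree a
α-SubFree (app a b) = α-SubFree a ×-⇔ α-SubFree b
α-SubFree (era x a) = α-SubFree a
α-SubFree (dup x x₁ x₂ a) = α-SubFree a
α-SubFree (sub x a b) = mk⇔ (λ ()) (λ ())

α₀-Λ®[/] : ∀ {M N} → M ~α₀ N → Λ®[/] M ⇔ Λ®[/] N
α₀-Λ®[/] (lam x y M y∉) = mk⇔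
  (λ { (lam _ _ wM x∈M) → lam y (ren x y M) (Λ®[/]-ren⁺ M x y y∉ wM) (ren-fv-y M x y y∉ x∈M) })
  (λ { (lam _ _ wM y∈M) → lam x M (Λ®[/]-ren⁻ M x y y∉ wM) (ren-fv-y⁻ M x y y∉ y∈M) })
α₀-Λ®[/] (dup₁ z x₁ x₂ y M y∉) = mk⇔
  (λ { (dup _ _ _ _ wM x₁∈M x₂∈M x₁≢x₂ z∉) →
        dup z y x₂ (ren x₁ y M) (Λ®[/]-ren⁺ M x₁ y y∉ wM) (ren-fv-y M x₁ y y∉ x₁∈M)
          (ren-fv⁺ M x₁ y y∉ x₂∈M (≢-sym x₁≢x₂)) (≢-sym (∈⇒≢ (∉vars⇒∉fv M y∉) x₂∈M))
          (subst (z ∉_) (≡-sym same-fv) z∉) })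
  (λ { (dup _ _ _ _ wM y∈M x₂∈M y≢x₂ z∉) →
        let (x₂∈M′ , x₂≢x₁) = ren-fv⁻ M x₁ y y∉ x₂∈M (≢-sym y≢x₂) in
        dup z x₁ x₂ M (Λ®[/]-ren⁻ M x₁ y y∉ wM) (ren-fv-y⁻ M x₁ y y∉ y∈M) x₂∈M′ (≢-sym x₂≢x₁)
          (subst (z ∉_) same-fv z∉) })
  where
  same-fv : (fv (ren x₁ y M) ∖ y) ∖ x₂ ≡ (fv M ∖ x₁) ∖ x₂
  same-fv = cong (_∖ x₂) (bound-fv M x₁ y y∉)
α₀-Λ®[/] (dup₂ z x₁ x₂ y M y∉) = mk⇔
  (λ { (dup _ _ _ _ wM x₁∈M x₂∈M x₁≢x₂ z∉) →
        dup z x₁ y (ren x₂ y M) (Λ®[/]-ren⁺ M x₂ y y∉ wM) (ren-fv⁺ M x₂ y y∉ x₁∈M x₁≢x₂)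
          (ren-fv-y M x₂ y y∉ x₂∈M) (∈⇒≢ (∉vars⇒∉fv M y∉) x₁∈M)
          (subst (z ∉_) (≡-sym same-fv) z∉) })
  (λ { (dup _ _ _ _ wM x₁∈M y∈M x₁≢y z∉) →
        let (x₁∈M′ , x₁≢x₂) = ren-fv⁻ M x₂ y y∉ x₁∈M x₁≢y in
        dup z x₁ x₂ M (Λ®[/]-ren⁻ M x₂ y y∉ wM) x₁∈M′ (ren-fv-y⁻ M x₂ y y∉ y∈M) x₁≢x₂
          (subst (z ∉_) same-fv z∉) })
  where
  same-fv : (fv (ren x₂ y M) ∖ x₁) ∖ y ≡ (fv M ∖ x₁) ∖ x₂
  same-fv = bound-fv₂ M x₁ x₂ y y∉
α₀-Λ®[/] (sub M x N y y∉) = mk⇔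
  (λ { (sub _ _ _ wM x∈M nN d) →
        sub (ren x y M) y N (Λ®[/]-ren⁺ M x y y∉ wM) (ren-fv-y M x y y∉ x∈M) nN
          (subst (λ l → Disjoint l (fv N)) (≡-sym (bound-fv M x y y∉)) d) })
  (λ { (sub _ _ _ wM y∈M nN d) →
        sub M x N (Λ®[/]-ren⁻ M x y y∉ wM) (ren-fv-y⁻ M x y y∉ y∈M) nN
          (subst (λ l → Disjoint l (fv N)) (bound-fv M x y y∉) d) })

lam-preserves : ∀ x {M M′} → fv M ≡ fv M′ → (Λ®[/] M → Λ®[/] M′) → Λ®[/] (lam x M) → Λ®[/] (lam x M′)
lam-preserves x e f (lam _ _ wM x∈M) = lam x _ (f wM) (subst (x ∈_) e x∈M)

app-preserves : ∀ {M M′ N N′} → fv M ≡ fv M′ → fv N ≡ fv N′ → (Λ®[/] M → Λ®[/] M′) → (Λ®[/] N → Λ®[/] N′) →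
                Λ®[/] (app M N) → Λ®[/] (app M′ N′)
app-preserves eM eN fM fN (app _ _ wM wN d) = app _ _ (fM wM) (fN wN) (subst₂ Disjoint eM eN d)

era-preserves : ∀ x {M M′} → fv M ≡ fv M′ → (Λ®[/] M → Λ®[/] M′) → Λ®[/] (era x M) → Λ®[/] (era x M′)
era-preserves x e f (era _ _ wM x∉M) = era x _ (f wM) (subst (x ∉_) e x∉M)

dup-preserves : ∀ x x₁ x₂ {M M′} → fv M ≡ fv M′ → (Λ®[/] M → Λ®[/] M′) →
                Λ®[/] (dup x x₁ x₂ M) → Λ®[/] (dup x x₁ x₂ M′)
dup-preserves x x₁ x₂ e f (dup _ _ _ _ wM x₁∈M x₂∈M x₁≢x₂ x∉) =
  dup x x₁ x₂ _ (f wM) (subst (x₁ ∈_) e x₁∈M) (subst (x₂ ∈_) e x₂∈M) x₁≢x₂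
    (subst (λ l → x ∉ (l ∖ x₁) ∖ x₂) e x∉)

sub-preserves : ∀ x {M M′ N N′} → fv M ≡ fv M′ → fv N ≡ fv N′ → (Λ®[/] M → Λ®[/] M′) →
                (Λ®[/] N → Λ®[/] N′) → (SubFree N → SubFree N′) →
                Λ®[/] (sub M x N) → Λ®[/] (sub M′ x N′)
sub-preserves x eM eN fM fN sN (sub _ _ _ wM x∈M nN d) =
  sub _ x _ (fM wM) (subst (x ∈_) eM x∈M) (toΛ® (fN (fromΛ® nN)) (sN (Λ®⇒SubFree nN)))
    (subst₂ Disjoint (cong (_∖ x) eM) eN d)

α-Λ®[/] : ∀ {M N} → M ≡α N → Λ®[/] M ⇔ Λ®[/] N
α-Λ®[/] (base b) = α₀-Λ®[/] b
α-Λ®[/] refl = ⇔-id _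
α-Λ®[/] (sym a) = ⇔-sym (α-Λ®[/] a)
α-Λ®[/] (trans a b) = α-Λ®[/] b ⇔-∘ α-Λ®[/] a
α-Λ®[/] (lam x a) =
  mk⇔ (lam-preserves x (α-fv a) (to (α-Λ®[/] a))) (lam-preserves x (≡-sym (α-fv a)) (from (α-Λ®[/] a)))
α-Λ®[/] (app a b) =
  mk⇔ (app-preserves (α-fv a) (α-fv b) (to (α-Λ®[/] a)) (to (α-Λ®[/] b)))
      (app-preserves (≡-sym (α-fv a)) (≡-sym (α-fv b)) (from (α-Λ®[/] a)) (from (α-Λ®[/] b)))
α-Λ®[/] (era x a) =
  mk⇔ (era-preserves x (α-fv a) (to (α-Λ®[/] a))) (era-preserves x (≡-sym (α-fv a)) (from (α-Λ®[/] a)))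
α-Λ®[/] (dup x x₁ x₂ a) =
  mk⇔ (dup-preserves x x₁ x₂ (α-fv a) (to (α-Λ®[/] a)))
      (dup-preserves x x₁ x₂ (≡-sym (α-fv a)) (from (α-Λ®[/] a)))
α-Λ®[/] (sub x a b) =
  mk⇔ (sub-preserves x (α-fv a) (α-fv b) (to (α-Λ®[/] a)) (to (α-Λ®[/] b)) (to (α-SubFree b)))
      (sub-preserves x (≡-sym (α-fv a)) (≡-sym (α-fv b)) (from (α-Λ®[/] a)) (from (α-Λ®[/] b))
                     (from (α-SubFree b)))

φ-eras : ∀ l M ρ → φ (eras l M) ρ ≡ Σ[ ρ ] l + φ M ρ
φ-eras [] M ρ = refl
φ-eras (v ∷ l) M ρ = ≡-trans (cong (ρ v +_) (φ-eras l M ρ)) (≡-sym (+-assoc (ρ v) _ _))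

*-distribʳ-+-+ : ∀ a b X c → a * X + (b * X + c) ≡ (a + b) * X + c
*-distribʳ-+-+ = solve-∀

⟦eras⟧ : ∀ l M ρ → ⟦ eras l M ⟧ ρ ≤ Σ[ ρ ⁺ ] l * suc (Σ[ ρ ⁺ ] l + φ M ρ) + ⟦ M ⟧ ρ
⟦eras⟧ [] M ρ = ≤-refl
⟦eras⟧ (v ∷ l) M ρ rewrite φ-eras l M ρ =
  ≤-trans (+-monoʳ-≤ (suc (ρ v) * suc (ρ v + (Σ[ ρ ] l + φ M ρ))) (⟦eras⟧ l M ρ))
    (≤-trans (+-mono-≤ (*-monoʳ-≤ (suc (ρ v)) head≤) (+-monoˡ-≤ (⟦ M ⟧ ρ) (*-monoʳ-≤ (Σ[ ρ ⁺ ] l) tail≤)))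
      (≤-reflexive (*-distribʳ-+-+ (suc (ρ v)) (Σ[ ρ ⁺ ] l) (suc (suc (ρ v) + Σ[ ρ ⁺ ] l + φ M ρ)) (⟦ M ⟧ ρ))))
  where
  head≤ : suc (ρ v + (Σ[ ρ ] l + φ M ρ)) ≤ suc (suc (ρ v) + Σ[ ρ ⁺ ] l + φ M ρ)
  head≤ = s≤s (≤-trans (≤-reflexive (≡-sym (+-assoc (ρ v) _ _)))
                       (+-monoˡ-≤ (φ M ρ) (+-mono-≤ (n≤1+n (ρ v)) (Σ-mono l (λ u → n≤1+n (ρ u))))))
  tail≤ : suc (Σ[ ρ ⁺ ] l + φ M ρ) ≤ suc (suc (ρ v) + Σ[ ρ ⁺ ] l + φ M ρ)
  tail≤ = s≤s (+-monoˡ-≤ (φ M ρ) (m≤n+m _ (suc (ρ v))))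

afterDups : Env → List Var → List Var → List Var → Env
afterDups ρ (v ∷ l) (y ∷ Y) (z ∷ Z) = afterDups (ρ [ y ≔ ρ v ] [ z ≔ ρ v ]) l Y Z
afterDups ρ _ _ _ = ρ

All∉-tail : ∀ {v} {l Y : List Var} → All (_∉ v ∷ l) Y → All (_∉ l) Y
All∉-tail = All.map ∉-tail

φ-dups : ∀ l Y Z T ρ → φ (dups l Y Z T) ρ ≡ φ T (afterDups ρ l Y Z)
φ-dups (v ∷ l) (y ∷ Y) (z ∷ Z) T ρ = φ-dups l Y Z T _
φ-dups [] Y Z T ρ = refl
φ-dups (v ∷ l) [] Z T ρ = refl
φ-dups (v ∷ l) (y ∷ Y) [] T ρ = refl

⟦dups⟧ : ∀ l Y Z T ρ → All (_∉ l) Y → All (_∉ l) Z →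
         ⟦ dups l Y Z T ⟧ ρ ≤ Σ[ ρ ⁺ ] l * suc (φ T (afterDups ρ l Y Z)) + ⟦ T ⟧ (afterDups ρ l Y Z)
⟦dups⟧ (v ∷ l) (y ∷ Y) (z ∷ Z) T ρ (y∉ ∷ Y∉) (z∉ ∷ Z∉)
  rewrite φ-dups l Y Z T (ρ [ y ≔ ρ v ] [ z ≔ ρ v ]) =
  ≤-trans (+-monoʳ-≤ (suc (ρ v) * suc A)
             (≤-trans (⟦dups⟧ l Y Z T ρ′ (All∉-tail Y∉) (All∉-tail Z∉))
                      (≤-reflexive (cong (λ s → s * suc A + C) (Σ⁺-agree l same-on-l)))))
    (≤-reflexive (*-distribʳ-+-+ (suc (ρ v)) (Σ[ ρ ⁺ ] l) (suc A) C))
  where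
  ρ′ : Env
  ρ′ = ρ [ y ≔ ρ v ] [ z ≔ ρ v ]
  A : ℕ
  A = φ T (afterDups ρ′ l Y Z)
  C : ℕ
  C = ⟦ T ⟧ (afterDups ρ′ l Y Z)
  same-on-l : Agree l ρ′ ρ
  same-on-l = agree-fresh² ρ y z (ρ v) l (∉-tail y∉) (∉-tail z∉)
⟦dups⟧ [] Y Z T ρ _ _ = ≤-refl
⟦dups⟧ (v ∷ l) [] Z T ρ _ _ = m≤n+m _ _
⟦dups⟧ (v ∷ l) (y ∷ Y) [] T ρ _ _ = m≤n+m _ _

afterDups-other : ∀ ρ l Y Z u → u ∉ Y → u ∉ Z → afterDups ρ l Y Z u ≡ ρ u
afterDups-other ρ (v ∷ l) (y ∷ Y) (z ∷ Z) u u∉Y u∉Z =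
  ≡-trans (afterDups-other _ l Y Z u (∉-tail u∉Y) (∉-tail u∉Z))
    (≡-trans (upd-other (ρ [ y ≔ ρ v ]) z (ρ v) u (∉-head u∉Z)) (upd-other ρ y (ρ v) u (∉-head u∉Y)))
afterDups-other ρ [] Y Z u _ _ = refl
afterDups-other ρ (v ∷ l) [] Z u _ _ = refl
afterDups-other ρ (v ∷ l) (y ∷ Y) [] u _ _ = refl

unique-++ˡ : ∀ (Y Z : List Var) → Unique (Y ++ Z) → Unique Y
unique-++ˡ [] Z _ = []
unique-++ˡ (y ∷ Y) Z (y∉ ∷ u) = ++⁻ˡ Y y∉ ∷ unique-++ˡ Y Z u

unique-++ʳ : ∀ (Y Z : List Var) → Unique (Y ++ Z) → Unique Z
unique-++ʳ [] Z u = u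
unique-++ʳ (y ∷ Y) Z (_ ∷ u) = unique-++ʳ Y Z u

unique-++-disjoint : ∀ (Y Z : List Var) → Unique (Y ++ Z) → Disjoint Y Z
unique-++-disjoint (y ∷ Y) Z (y∉ ∷ _) (here refl) q = All.lookup y∉ (∈-++⁺ʳ Y q) refl
unique-++-disjoint (y ∷ Y) Z (_ ∷ u) (there p) q = unique-++-disjoint Y Z u p q

Reads : Env → Env → List Var → List Var → Set
Reads σ ρ (v ∷ l) (y ∷ Y) = σ y ≡ ρ v × Reads σ ρ l Y
Reads σ ρ _ _ = ⊤

Reads-source : ∀ σ ρ ρ′ l Y → Agree l ρ′ ρ → Reads σ ρ′ l Y → Reads σ ρ l Y
Reads-source σ ρ ρ′ (v ∷ l) (y ∷ Y) ag (e , r) = ≡-trans e (ag v (here refl)) , Reads-source σ ρ ρ′ l Y (λ u → ag u ∘ there) r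
Reads-source σ ρ ρ′ [] Y _ _ = tt
Reads-source σ ρ ρ′ (v ∷ l) [] _ _ = tt

Reads-target : ∀ σ σ′ ρ l Y → Agree Y σ′ σ → Reads σ ρ l Y → Reads σ′ ρ l Y
Reads-target σ σ′ ρ (v ∷ l) (y ∷ Y) ag (e , r) = ≡-trans (ag y (here refl)) e , Reads-target σ σ′ ρ l Y (λ u → ag u ∘ there) r
Reads-target σ σ′ ρ [] Y _ _ = tt
Reads-target σ σ′ ρ (v ∷ l) [] _ _ = tt

afterDups-reads : ∀ ρ l Y Z → length Y ≡ length l → length Z ≡ length l → Unique Y → Unique Z →
                  Disjoint Y Z → All (_∉ l) Y → All (_∉ l) Z →
                  Reads (afterDups ρ l Y Z) ρ l Y × Reads (afterDups ρ l Y Z) ρ l Z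
afterDups-reads ρ (v ∷ l) (y ∷ Y) (z ∷ Z) ly lz (y∉Y ∷ uY) (z∉Z ∷ uZ) YZ (y∉ ∷ Y∉) (z∉ ∷ Z∉) =
  (≡-trans (afterDups-other ρ′ l Y Z y (Unique[x∷xs]⇒x∉xs (y∉Y ∷ uY)) (YZ (here refl) ∘ there))
           (upd²-first ρ y z (ρ v)) ,
   Reads-source _ ρ ρ′ l Y same-on-l (proj₁ ih)) ,
  (≡-trans (afterDups-other ρ′ l Y Z z (λ p → YZ (there p) (here refl)) (Unique[x∷xs]⇒x∉xs (z∉Z ∷ uZ)))
           (upd-same (ρ [ y ≔ ρ v ]) z (ρ v)) ,
   Reads-source _ ρ ρ′ l Z same-on-l (proj₂ ih))
  where
  ρ′ : Env
  ρ′ = ρ [ y ≔ ρ v ] [ z ≔ ρ v ]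
  same-on-l : Agree l ρ′ ρ
  same-on-l = agree-fresh² ρ y z (ρ v) l (∉-tail y∉) (∉-tail z∉)
  ih : Reads (afterDups ρ′ l Y Z) ρ′ l Y × Reads (afterDups ρ′ l Y Z) ρ′ l Z
  ih = afterDups-reads ρ′ l Y Z (suc-injective ly) (suc-injective lz) uY uZ
         (λ p q → YZ (there p) (there q)) (All∉-tail Y∉) (All∉-tail Z∉)
afterDups-reads ρ [] Y Z _ _ _ _ _ _ _ = tt , tt
afterDups-reads ρ (v ∷ l) [] Z () _ _ _ _ _ _
afterDups-reads ρ (v ∷ l) (y ∷ Y) [] _ () _ _ _ _ _

rn-∈ : ∀ x y z {C : List Var} → rn x y z ∈ y ∷ z ∷ C
rn-∈ x y z with z ≡ᵇ x
... | true = here refl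
... | false = there (here refl)

⊆-cons : ∀ {y} w {A C : List Var} → A ⊆ y ∷ C → w ∷ A ⊆ y ∷ w ∷ C
⊆-cons w A⊆ (here refl) = there (here refl)
⊆-cons w A⊆ (there p) with A⊆ p
... | here e = here e
... | there q = there (there q)

rn-cons : ∀ x y z {A C : List Var} → A ⊆ y ∷ C → rn x y z ∷ A ⊆ y ∷ z ∷ C
rn-cons x y z A⊆ (here refl) = rn-∈ x y z
rn-cons x y z A⊆ (there p) = ⊆-cons z A⊆ (there p)

⊆-++ : ∀ {y} {A B C D : List Var} → A ⊆ y ∷ C → B ⊆ y ∷ D → A ++ B ⊆ y ∷ (C ++ D)
⊆-++ {A = A} {C = C} A⊆ B⊆ p with ∈-++⁻ A p
... | inj₁ q = ∷⁺ʳ _ ∈-++⁺ˡ (A⊆ q)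
... | inj₂ q = ∷⁺ʳ _ (∈-++⁺ʳ C) (B⊆ q)

vars-ren : ∀ M x y → vars (ren x y M) ⊆ y ∷ vars M
vars-ren (var z) x y (here refl) = rn-∈ x y z
vars-ren (lam z M) x y with z ≡ᵇ x
... | true = there
... | false = ⊆-cons z (vars-ren M x y)
vars-ren (app M N) x y = ⊆-++ (vars-ren M x y) (vars-ren N x y)
vars-ren (era z M) x y = rn-cons x y z (vars-ren M x y)
vars-ren (dup z z₁ z₂ M) x y with z₁ ≡ᵇ x | z₂ ≡ᵇ x
... | true | _ = rn-cons x y z (⊆-cons z₁ (⊆-cons z₂ there))
... | false | true = rn-cons x y z (⊆-cons z₁ (⊆-cons z₂ there))
... | false | false = rn-cons x y z (⊆-cons z₁ (⊆-cons z₂ (vars-ren M x y)))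
vars-ren (sub M z N) x y with z ≡ᵇ x
... | true = ⊆-cons z (⊆-++ there (vars-ren N x y))
... | false = ⊆-cons z (⊆-++ (vars-ren M x y) (vars-ren N x y))

vars-rens : ∀ l Y N → vars (rens (zip l Y) N) ⊆ Y ++ vars N
vars-rens [] Y N = ∈-++⁺ʳ Y
vars-rens (v ∷ l) [] N p = p
vars-rens (v ∷ l) (y ∷ Y) N p with vars-ren (rens (zip l Y) N) v y p
... | here e = here e
... | there q = there (vars-rens l Y N q)

-- The environment under which the renamed copy is evaluated like the original:
-- each v ∈ l reads the weight of the corresponding y ∈ Y.
readBack : Env → List Var → List Var → Env
readBack σ (v ∷ l) (y ∷ Y) = readBack (σ [ v ≔ σ y ]) l Y
readBack σ _ _ = σ

rens-law : ∀ F → RenamingLaw F → ∀ l Y N σ → Unique Y → All (_∉ vars N) Y →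
           F (rens (zip l Y) N) σ ≡ F N (readBack σ l Y)
rens-law F F-ren [] Y N σ _ _ = refl
rens-law F F-ren (v ∷ l) [] N σ _ _ = refl
rens-law F F-ren (v ∷ l) (y ∷ Y) N σ (y∉Y ∷ uY) (y∉N ∷ Y∉N) =
  ≡-trans (F-ren (rens (zip l Y) N) v y σ fresh) (rens-law F F-ren l Y N _ uY Y∉N)
  where
  fresh : y ∉ vars (rens (zip l Y) N)
  fresh p with ∈-++⁻ Y (vars-rens l Y N p)
  ... | inj₁ q = Unique[x∷xs]⇒x∉xs (y∉Y ∷ uY) q
  ... | inj₂ q = y∉N q

readBack-other : ∀ σ l Y u → u ∉ l → readBack σ l Y u ≡ σ u
readBack-other σ (v ∷ l) (y ∷ Y) u u∉ =
  ≡-trans (readBack-other _ l Y u (∉-tail u∉)) (upd-other σ v (σ y) u (∉-head u∉))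
readBack-other σ [] Y u _ = refl
readBack-other σ (v ∷ l) [] u _ = refl

readBack-reads : ∀ l Y σ ρ → length Y ≡ length l → Reads σ ρ l Y → All (_∉ l) Y →
                 Agree l (readBack σ l Y) ρ
readBack-reads (v ∷ l) (y ∷ Y) σ ρ ly (σy≡ρv , r) (y∉ ∷ Y∉) u p with u ∈? l
... | yes q = readBack-reads l Y _ ρ (suc-injective ly) (Reads-target σ _ ρ l Y Y-unchanged r) (All∉-tail Y∉) u q
  where
  Y-unchanged : Agree Y (σ [ v ≔ σ y ]) σ
  Y-unchanged w w∈Y = upd-other σ v (σ y) w λ { refl → All.lookup Y∉ w∈Y (here refl) }
... | no u∉l with p
...   | there q = ⊥-elim (u∉l q)
...   | here refl = ≡-trans (readBack-other _ l Y u u∉l) (≡-trans (upd-same σ u (σ y)) σy≡ρv)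
readBack-reads [] Y σ ρ _ _ _ u ()
readBack-reads (v ∷ l) [] σ ρ () _ _ u p

Decreases : Term → Term → Set
Decreases S R = ∀ ρ → ⟦ R ⟧ ρ < ⟦ S ⟧ ρ × φ R ρ ≤ φ S ρ

-- L < R follows from R = suc L + k; each rule below exhibits such an excess
-- k by a ring normalisation (the `excess-…` identities).
<-by-excess : ∀ {L R} k → R ≡ suc L + k → L < R
<-by-excess {L} k e = subst (suc L ≤_) (≡-sym e) (m≤m+n (suc L) k)

-- Substituting inside a well-formed M: the weight x receives in the measure
-- (Wt ⟦ N ⟧) exceeds the one it receives in φ (φ N), so φ M grows by 1 + e.
substitution-gap : ∀ M σ x N ρ → Λ®[/] M → x ∈ fv M →
                   ∃[ e ] φ M (σ [ x ≔ Wt (⟦ N ⟧ ρ) ]) ≡ suc (φ M (σ [ x ≔ φ N ρ ])) + e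
substitution-gap M σ x N ρ wM x∈M
  with m≤n⇒∃[o]m+o≡n (φ-strict M _ _ x 1 wM x∈M (upd-mono σ σ x _ _ (λ _ → ≤-refl) (<⇒≤ (φ<Wt⟦⟧ N ρ)))
                         (subst₂ (λ a b → 1 + a ≤ b) (≡-sym (upd-same σ x _)) (≡-sym (upd-same σ x _)) (φ<Wt⟦⟧ N ρ)))
... | e , eq = e , ≡-sym eq

dec-var : ∀ x N → Decreases (sub (var x) x N) N
dec-var x N ρ rewrite upd-same ρ x (φ N ρ) | upd-same ρ x (Wt (⟦ N ⟧ ρ)) =
  s≤s (≤-trans (m≤n+m (⟦ N ⟧ ρ) (φ N ρ)) (m≤m+n _ _)) , ≤-refl

-- (λy.M)[N/x] → λy.M[N/x]: the body gains e from the gap, pays nothing else.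
excess-lam : ∀ A n C e → suc A + n + (suc (suc A + e) + C) ≡ suc (suc A + (suc A + n + C)) + e
excess-lam = solve-∀

dec-lam : ∀ y M x N → x ≢ y → y ∉ fv N → Λ®[/] (sub (lam y M) x N) →
          Decreases (sub (lam y M) x N) (lam y (sub M x N))
dec-lam y M x N x≢y y∉N (sub _ _ _ (lam _ _ wM _) x∈ _ _) ρ
  with substitution-gap M (ρ [ y ≔ 0 ]) x N ρ wM (proj₁ (∈-∖⁻ (fv M) x∈))
... | e , gap = <-by-excess e measure , ≤-reflexive weight
  where
  σ : Env
  σ = ρ [ y ≔ 0 ]
  f : ℕ
  f = φ N ρ
  W : ℕ
  W = Wt (⟦ N ⟧ ρ)
  φN-same : φ N σ ≡ f
  φN-same = φ-fv N σ ρ (agree-fresh ρ y 0 (fv N) y∉N)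
  ⟦N⟧-same : ⟦ N ⟧ σ ≡ ⟦ N ⟧ ρ
  ⟦N⟧-same = ⟦⟧-fv N σ ρ (agree-fresh ρ y 0 (fv N) y∉N)
  swap : ∀ a → (ρ [ x ≔ a ] [ y ≔ 0 ]) ≐ (σ [ x ≔ a ])
  swap a = upd-comm ρ y x a 0 (≢-sym x≢y)
  measure : ⟦ sub (lam y M) x N ⟧ ρ ≡ suc (⟦ lam y (sub M x N) ⟧ ρ) + e
  measure rewrite φ-≐ M (swap f) | φ-≐ M (swap W) | ⟦⟧-≐ M (swap W) | φN-same | ⟦N⟧-same | gap =
    excess-lam (φ M (σ [ x ≔ f ])) (⟦ N ⟧ ρ) (⟦ M ⟧ (σ [ x ≔ W ])) e
  weight : φ (lam y (sub M x N)) ρ ≡ φ (sub (lam y M) x N) ρ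
  weight = ≡-trans (cong (λ a → φ M (σ [ x ≔ a ])) φN-same) (≡-sym (φ-≐ M (swap f)))

-- (M P)[N/x] → M[N/x] P and (M P)[N/x] → M P[N/x]: the untouched side does
-- not see x, by linearity.
excess-appˡ : ∀ A P n C Q e → suc (A + P) + n + (suc ((suc A + e) + P) + (C + Q)) ≡ suc (suc (A + P) + ((suc A + n + C) + Q)) + (P + e)
excess-appˡ = solve-∀

dec-appˡ : ∀ M P x N → x ∈ fv M → Λ®[/] (sub (app M P) x N) → Decreases (sub (app M P) x N) (app (sub M x N) P)
dec-appˡ M P x N x∈M (sub _ _ _ (app _ _ wM _ d) _ _ _) ρ with substitution-gap M ρ x N ρ wM x∈M
... | e , gap = <-by-excess (φ P ρ + e) measure , ≤-reflexive (cong (φ M (ρ [ x ≔ φ N ρ ]) +_) (≡-sym φP-f))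
  where
  P-fresh : ∀ a → Agree (fv P) (ρ [ x ≔ a ]) ρ
  P-fresh a = agree-fresh ρ x a (fv P) (d x∈M)
  φP-f : φ P (ρ [ x ≔ φ N ρ ]) ≡ φ P ρ
  φP-f = φ-fv P _ _ (P-fresh (φ N ρ))
  measure : ⟦ sub (app M P) x N ⟧ ρ ≡ suc (⟦ app (sub M x N) P ⟧ ρ) + (φ P ρ + e)
  measure rewrite φP-f | φ-fv P _ _ (P-fresh (Wt (⟦ N ⟧ ρ))) | ⟦⟧-fv P _ _ (P-fresh (Wt (⟦ N ⟧ ρ))) | gap =
    excess-appˡ (φ M (ρ [ x ≔ φ N ρ ])) (φ P ρ) (⟦ N ⟧ ρ) (⟦ M ⟧ (ρ [ x ≔ Wt (⟦ N ⟧ ρ) ])) (⟦ P ⟧ ρ) e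

excess-appʳ : ∀ M A n C Q e → suc (M + A) + n + (suc (M + (suc A + e)) + (Q + C)) ≡ suc (suc (M + A) + (Q + (suc A + n + C))) + (M + e)
excess-appʳ = solve-∀

dec-appʳ : ∀ M P x N → x ∈ fv P → Λ®[/] (sub (app M P) x N) → Decreases (sub (app M P) x N) (app M (sub P x N))
dec-appʳ M P x N x∈P (sub _ _ _ (app _ _ _ wP d) _ _ _) ρ with substitution-gap P ρ x N ρ wP x∈P
... | e , gap = <-by-excess (φ M ρ + e) measure , ≤-reflexive (cong (_+ φ P (ρ [ x ≔ φ N ρ ])) (≡-sym φM-f))
  where
  M-fresh : ∀ a → Agree (fv M) (ρ [ x ≔ a ]) ρ
  M-fresh a = agree-fresh ρ x a (fv M) (λ x∈M → d x∈M x∈P)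
  φM-f : φ M (ρ [ x ≔ φ N ρ ]) ≡ φ M ρ
  φM-f = φ-fv M _ _ (M-fresh (φ N ρ))
  measure : ⟦ sub (app M P) x N ⟧ ρ ≡ suc (⟦ app M (sub P x N) ⟧ ρ) + (φ M ρ + e)
  measure rewrite φM-f | φ-fv M _ _ (M-fresh (Wt (⟦ N ⟧ ρ))) | ⟦⟧-fv M _ _ (M-fresh (Wt (⟦ N ⟧ ρ))) | gap =
    excess-appʳ (φ M ρ) (φ P (ρ [ x ≔ φ N ρ ])) (⟦ N ⟧ ρ) (⟦ P ⟧ (ρ [ x ≔ Wt (⟦ N ⟧ ρ) ])) (⟦ M ⟧ ρ) e

excess-era : ∀ a A n C e → suc (a + A) + n + (suc a * suc (a + (suc A + e)) + C) ≡ suc (suc a * suc (a + A) + (suc A + n + C)) + (a + a + e + a * e)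
excess-era = solve-∀

dec-era : ∀ y M x N → x ≢ y → Λ®[/] (sub (era y M) x N) → Decreases (sub (era y M) x N) (era y (sub M x N))
dec-era y M x N x≢y (sub _ _ _ (era _ _ _ _) (here x≡y) _ _) ρ = ⊥-elim (x≢y x≡y)
dec-era y M x N x≢y (sub _ _ _ (era _ _ wM _) (there x∈M) _ _) ρ with substitution-gap M ρ x N ρ wM x∈M
... | e , gap = <-by-excess (ρ y + ρ y + e + ρ y * e) measure , ≤-reflexive (cong (_+ φ M (ρ [ x ≔ φ N ρ ])) (≡-sym y-f))
  where
  y-f : (ρ [ x ≔ φ N ρ ]) y ≡ ρ y
  y-f = upd-other ρ x (φ N ρ) y (≢-sym x≢y)
  measure : ⟦ sub (era y M) x N ⟧ ρ ≡ suc (⟦ era y (sub M x N) ⟧ ρ) + (ρ y + ρ y + e + ρ y * e)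
  measure rewrite y-f | upd-other ρ x (Wt (⟦ N ⟧ ρ)) y (≢-sym x≢y) | gap =
    excess-era (ρ y) (φ M (ρ [ x ≔ φ N ρ ])) (⟦ N ⟧ ρ) (⟦ M ⟧ (ρ [ x ≔ Wt (⟦ N ⟧ ρ) ])) e

-- (x ⊙ M)[N/x] → Fv(N) ⊙ M: the erasures of Fv(N) are paid for by the
-- weight W that x carries in the measure, since Σ (Fv N) ≤ ⟦ N ⟧ < W.
excess-era-x : ∀ W A f n C → suc (f + A) + n + (suc W * suc (W + A) + C) ≡ suc (W * suc (W + A) + C) + (suc (f + A) + n + W + A)
excess-era-x = solve-∀

dec-era-x : ∀ M x N → Λ®[/] (sub (era x M) x N) → Decreases (sub (era x M) x N) (eras (fv N) M)
dec-era-x M x N (sub _ _ _ (era _ _ _ x∉M) _ nN _) ρ = measure , weight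
  where
  f : ℕ
  f = φ N ρ
  n : ℕ
  n = ⟦ N ⟧ ρ
  W : ℕ
  W = Wt n
  A : ℕ
  A = φ M ρ
  C : ℕ
  C = ⟦ M ⟧ ρ
  K : ℕ
  K = Σ[ ρ ⁺ ] (fv N)
  M-fresh : ∀ a → Agree (fv M) (ρ [ x ≔ a ]) ρ
  M-fresh a = agree-fresh ρ x a (fv M) x∉M
  measureS : ⟦ sub (era x M) x N ⟧ ρ ≡ suc (f + A) + n + (suc W * suc (W + A) + C)
  measureS rewrite upd-same ρ x f | upd-same ρ x W
                 | φ-fv M _ _ (M-fresh f) | φ-fv M _ _ (M-fresh W) | ⟦⟧-fv M _ _ (M-fresh W) = refl
  K≤W : K ≤ W
  K≤W = ≤-trans (Σ⁺≤⟦⟧ N ρ) (≤Wt n)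
  measure : ⟦ eras (fv N) M ⟧ ρ < ⟦ sub (era x M) x N ⟧ ρ
  measure = ≤-<-trans (⟦eras⟧ (fv N) M ρ)
    (≤-<-trans (+-monoˡ-≤ C (*-mono-≤ K≤W (s≤s (+-monoˡ-≤ A K≤W))))
      (subst (W * suc (W + A) + C <_) (≡-sym measureS) (<-by-excess (suc (f + A) + n + W + A) (excess-era-x W A f n C))))
  weight : φ (eras (fv N) M) ρ ≤ φ (sub (era x M) x N) ρ
  weight rewrite φ-eras (fv N) M ρ | upd-same ρ x f | φ-fv M _ _ (M-fresh f) =
    +-monoˡ-≤ A (Σ≤φ N ρ (fromΛ® nN))

excess-dup : ∀ a A n C e → suc A + n + (suc a * suc (suc A + e) + C) ≡ suc (suc a * suc A + (suc A + n + C)) + (e + a + a * e)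
excess-dup = solve-∀

dec-dup : ∀ y y₁ y₂ M x N → x ≢ y → y₁ ∉ fv N → y₂ ∉ fv N → Λ®[/] (sub (dup y y₁ y₂ M) x N) →
          Decreases (sub (dup y y₁ y₂ M) x N) (dup y y₁ y₂ (sub M x N))
dec-dup y y₁ y₂ M x N x≢y _ _ (sub _ _ _ (dup _ _ _ _ _ _ _ _ _) (here x≡y) _ _) ρ = ⊥-elim (x≢y x≡y)
dec-dup y y₁ y₂ M x N x≢y y₁∉N y₂∉N (sub _ _ _ (dup _ _ _ _ wM _ _ _ _) (there x∈) _ _) ρ
  with ∈-∖⁻ (fv M ∖ y₁) x∈
... | x∈′ , x≢y₂ with ∈-∖⁻ (fv M) x∈′
... | x∈M , x≢y₁ with substitution-gap M (ρ [ y₁ ≔ ρ y ] [ y₂ ≔ ρ y ]) x N ρ wM x∈M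
... | e , gap = <-by-excess (e + ρ y + ρ y * e) measure , ≤-reflexive weight
  where
  a : ℕ
  a = ρ y
  τ : Env
  τ = ρ [ y₁ ≔ a ] [ y₂ ≔ a ]
  f : ℕ
  f = φ N ρ
  W : ℕ
  W = Wt (⟦ N ⟧ ρ)
  swap : ∀ c → (ρ [ x ≔ c ] [ y₁ ≔ a ] [ y₂ ≔ a ]) ≐ (τ [ x ≔ c ])
  swap c = ≐-sym (≐-trans (upd-comm (ρ [ y₁ ≔ a ]) x y₂ a c x≢y₂) (upd-cong _ _ y₂ a (upd-comm ρ x y₁ a c x≢y₁)))
  N-same : Agree (fv N) τ ρ
  N-same = agree-fresh² ρ y₁ y₂ a (fv N) y₁∉N y₂∉N
  y-f : (ρ [ x ≔ f ]) y ≡ ρ y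
  y-f = upd-other ρ x f y (≢-sym x≢y)
  measure : ⟦ sub (dup y y₁ y₂ M) x N ⟧ ρ ≡ suc (⟦ dup y y₁ y₂ (sub M x N) ⟧ ρ) + (e + ρ y + ρ y * e)
  measure rewrite y-f | upd-other ρ x W y (≢-sym x≢y) | φ-≐ M (swap f) | φ-≐ M (swap W) | ⟦⟧-≐ M (swap W)
                | φ-fv N τ ρ N-same | ⟦⟧-fv N τ ρ N-same | gap =
    excess-dup a (φ M (τ [ x ≔ f ])) (⟦ N ⟧ ρ) (⟦ M ⟧ (τ [ x ≔ W ])) e
  weight : φ (dup y y₁ y₂ (sub M x N)) ρ ≡ φ (sub (dup y y₁ y₂ M) x N) ρ
  weight rewrite y-f | φ-≐ M (swap f) | φ-fv N τ ρ N-same = refl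

-- Under the environment σ produced by the duplications, both copies weigh
-- exactly what N weighs under ρ, so the body is the old body with x₁, x₂
-- receiving N's weights directly; the cost Σ X * (…) of the new duplications
-- is covered by the factor Wt ⟦ N ⟧ that x carries in the old measure.

excess-dup-x : ∀ n Af AW B → suc Af + n + (suc (suc (suc (n + n))) * suc AW + B) ≡ suc (n * suc AW + (suc Af + n + (suc AW + n + B))) + (1 + AW + AW + n * AW)
excess-dup-x = solve-∀

-- The arithmetic core: K = Σ (1 + ρ)(X) ≤ n = ⟦ N ⟧, and the body weights
-- of the reduct are dominated by AW, the one with all of x, x₁, x₂ at Wt n.
dup-x-arith : ∀ K n Af AWf AW B → K ≤ n → Af ≤ AW → AWf ≤ AW →
              K * suc Af + (suc Af + n + (suc AWf + n + B)) < suc Af + n + (suc (Wt n) * suc AW + B)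
dup-x-arith K n Af AWf AW B K≤n Af≤AW AWf≤AW =
  ≤-<-trans (+-mono-≤ (*-mono-≤ K≤n (s≤s Af≤AW)) (+-monoʳ-≤ (suc Af + n) (+-monoˡ-≤ B (+-monoˡ-≤ n (s≤s AWf≤AW)))))
    (<-by-excess (1 + AW + AW + n * AW) (excess-dup-x n Af AW B))

module DuplicationStep (x₁ x₂ : Var) (M : Term) (x : Var) (N : Term) (Y Z : List Var)
                       (lY : length Y ≡ length (fv N)) (lZ : length Z ≡ length (fv N))
                       (uYZ : Unique (Y ++ Z)) (fresh : All (_∉ vars (sub (dup x x₁ x₂ M) x N)) (Y ++ Z))
                       (wM : Λ®[/] M) (x₁≢x₂ : x₁ ≢ x₂) (x∉ : x ∉ (fv M ∖ x₁) ∖ x₂) (ρ : Env) where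

  X : List Var
  X = fv N
  N₁ N₂ body : Term
  N₁ = rens (zip X Y) N
  N₂ = rens (zip X Z) N
  body = sub (sub M x₁ N₁) x₂ N₂
  σ : Env
  σ = afterDups ρ X Y Z
  f n W : ℕ
  f = φ N ρ
  n = ⟦ N ⟧ ρ
  W = Wt n

  ∉N : ∀ {v} → v ∉ vars (sub (dup x x₁ x₂ M) x N) → v ∉ vars N
  ∉N v∉ = v∉ ∘ there ∘ ∈-++⁺ʳ (x ∷ x₁ ∷ x₂ ∷ vars M)

  ∉M : ∀ {v} → v ∉ vars (sub (dup x x₁ x₂ M) x N) → v ∉ vars M
  ∉M v∉ = v∉ ∘ there ∘ there ∘ there ∘ there ∘ ∈-++⁺ˡ

  Y-fresh : All (_∉ vars (sub (dup x x₁ x₂ M) x N)) Y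
  Y-fresh = ++⁻ˡ Y fresh
  Z-fresh : All (_∉ vars (sub (dup x x₁ x₂ M) x N)) Z
  Z-fresh = ++⁻ʳ Y fresh
  uY : Unique Y
  uY = unique-++ˡ Y Z uYZ
  uZ : Unique Z
  uZ = unique-++ʳ Y Z uYZ

  Y∉X : All (_∉ X) Y
  Y∉X = All.map (λ v∉ → ∉N v∉ ∘ fv⊆vars N) Y-fresh
  Z∉X : All (_∉ X) Z
  Z∉X = All.map (λ v∉ → ∉N v∉ ∘ fv⊆vars N) Z-fresh

  reads : Reads σ ρ X Y × Reads σ ρ X Z
  reads = afterDups-reads ρ X Y Z lY lZ uY uZ (unique-++-disjoint Y Z uYZ) Y∉X Z∉X

  copy-value : ∀ F → DependsOnFv F → RenamingLaw F → ∀ V → Unique V → All (_∉ vars N) V →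
               length V ≡ length X → All (_∉ X) V → ∀ τ → Reads τ ρ X V → F (rens (zip X V) N) τ ≡ F N ρ
  copy-value F F-fv F-ren V uV V∉N lV V∉X τ r =
    ≡-trans (rens-law F F-ren X V N τ uV V∉N) (F-fv N _ _ (readBack-reads X V τ ρ lV r V∉X))

  x₂∉Y : x₂ ∉ Y
  x₂∉Y p = All.lookup Y-fresh p (there (there (there (here refl))))

  reads₁ : ∀ c → Reads (σ [ x₂ ≔ c ]) ρ X Y
  reads₁ c = Reads-target σ _ ρ X Y (λ u u∈Y → upd-other σ x₂ c u λ { refl → x₂∉Y u∈Y }) (proj₁ reads)

  φN₁ : ∀ c → φ N₁ (σ [ x₂ ≔ c ]) ≡ f
  φN₁ c = copy-value φ φ-fv ren-φ Y uY (All.map ∉N Y-fresh) lY Y∉X _ (reads₁ c)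
  ⟦N₁⟧ : ∀ c → ⟦ N₁ ⟧ (σ [ x₂ ≔ c ]) ≡ n
  ⟦N₁⟧ c = copy-value ⟦_⟧ ⟦⟧-fv ren-⟦⟧ Y uY (All.map ∉N Y-fresh) lY Y∉X _ (reads₁ c)
  φN₂ : φ N₂ σ ≡ f
  φN₂ = copy-value φ φ-fv ren-φ Z uZ (All.map ∉N Z-fresh) lZ Z∉X σ (proj₂ reads)
  ⟦N₂⟧ : ⟦ N₂ ⟧ σ ≡ n
  ⟦N₂⟧ = copy-value ⟦_⟧ ⟦⟧-fv ren-⟦⟧ Z uZ (All.map ∉N Z-fresh) lZ Z∉X σ (proj₂ reads)

  ≢x : ∀ {v} → v ∈ fv M → v ≢ x₁ → v ≢ x₂ → v ≢ x
  ≢x v∈M v≢x₁ v≢x₂ refl = x∉ (∈-∖⁺ _ (∈-∖⁺ (fv M) v∈M v≢x₁) v≢x₂)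

  body-env : ∀ a b c → Agree (fv M) (σ [ x₂ ≔ a ] [ x₁ ≔ b ]) (ρ [ x ≔ c ] [ x₁ ≔ b ] [ x₂ ≔ a ])
  body-env a b c v v∈M with v ≡ᵇ x₁ in e₁ | v ≡ᵇ x₂ in e₂
  ... | true | true = ⊥-elim (x₁≢x₂ (≡-trans (≡-sym (≡ᵇ-true⇒≡ v x₁ e₁)) (≡ᵇ-true⇒≡ v x₂ e₂)))
  ... | true | false = refl
  ... | false | true = refl
  ... | false | false rewrite ≢⇒≡ᵇ-false v x (≢x v∈M (≡ᵇ-false⇒≢ v x₁ e₁) (≡ᵇ-false⇒≢ v x₂ e₂)) =
    afterDups-other ρ X Y Z v (λ p → ∉M (All.lookup Y-fresh p) v∈vars) (λ p → ∉M (All.lookup Z-fresh p) v∈vars)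
    where
      v∈vars : v ∈ vars M
      v∈vars = fv⊆vars M v∈M

  Af AWf AW B : ℕ
  Af = φ M (ρ [ x ≔ f ] [ x₁ ≔ f ] [ x₂ ≔ f ])
  AWf = φ M (ρ [ x ≔ W ] [ x₁ ≔ f ] [ x₂ ≔ W ])
  AW = φ M (ρ [ x ≔ W ] [ x₁ ≔ W ] [ x₂ ≔ W ])
  B = ⟦ M ⟧ (ρ [ x ≔ W ] [ x₁ ≔ W ] [ x₂ ≔ W ])

  φ-body : φ body σ ≡ Af
  φ-body rewrite φN₂ | φN₁ f = φ-fv M _ _ (body-env f f f)

  ⟦body⟧ : ⟦ body ⟧ σ ≡ suc Af + n + (suc AWf + n + B)
  ⟦body⟧ rewrite φ-body | ⟦N₂⟧ | φN₁ W | ⟦N₁⟧ W | φ-fv M _ _ (body-env W f W) | ⟦⟧-fv M _ _ (body-env W W W) = refl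

  ⟦redex⟧ : ⟦ sub (dup x x₁ x₂ M) x N ⟧ ρ ≡ suc Af + n + (suc W * suc AW + B)
  ⟦redex⟧ rewrite upd-same ρ x f | upd-same ρ x W = refl

  φ-redex : φ (sub (dup x x₁ x₂ M) x N) ρ ≡ Af
  φ-redex rewrite upd-same ρ x f = refl

  f≤W : f ≤ W
  f≤W = <⇒≤ (φ<Wt⟦⟧ N ρ)

  decreases : ⟦ dups X Y Z body ⟧ ρ < ⟦ sub (dup x x₁ x₂ M) x N ⟧ ρ × φ (dups X Y Z body) ρ ≤ φ (sub (dup x x₁ x₂ M) x N) ρ
  decreases =
    ≤-<-trans (⟦dups⟧ X Y Z body ρ Y∉X Z∉X)
      (subst₂ _<_ (≡-sym (cong₂ (λ u v → Σ[ ρ ⁺ ] X * suc u + v) φ-body ⟦body⟧)) (≡-sym ⟦redex⟧)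
        (dup-x-arith (Σ[ ρ ⁺ ] X) n Af AWf AW B (Σ⁺≤⟦⟧ N ρ) Af≤AW AWf≤AW)) ,
    ≤-reflexive (≡-trans (φ-dups X Y Z body ρ) (≡-trans φ-body (≡-sym φ-redex)))
    where
    Af≤AW : Af ≤ AW
    Af≤AW = φ-mono M _ _ (upd-mono _ _ x₂ f W (upd-mono _ _ x₁ f W (upd-mono ρ ρ x f W (λ _ → ≤-refl) f≤W) f≤W) f≤W)
    AWf≤AW : AWf ≤ AW
    AWf≤AW = φ-mono M _ _ (upd-mono _ _ x₂ W W (upd-mono _ _ x₁ f W (λ _ → ≤-refl) f≤W) ≤-refl)

dec-dup-x : ∀ x₁ x₂ M x N (Y Z : List Var) → length Y ≡ length (fv N) → length Z ≡ length (fv N) →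
            Unique (Y ++ Z) → All (_∉ vars (sub (dup x x₁ x₂ M) x N)) (Y ++ Z) →
            Λ®[/] (sub (dup x x₁ x₂ M) x N) →
            Decreases (sub (dup x x₁ x₂ M) x N)
                      (dups (fv N) Y Z (sub (sub M x₁ (rens (zip (fv N) Y) N)) x₂ (rens (zip (fv N) Z) N)))
dec-dup-x x₁ x₂ M x N Y Z lY lZ uYZ fresh (sub _ _ _ (dup _ _ _ _ wM _ _ x₁≢x₂ x∉) _ _ _) ρ =
  DuplicationStep.decreases x₁ x₂ M x N Y Z lY lZ uYZ fresh wM x₁≢x₂ x∉ ρ

root-decreases : ∀ {S R} → Λ®[/] S → S ⟶₀ R → Decreases S R
root-decreases w (r-var x N) = dec-var x N
root-decreases w (r-lam y M x N x≢y y∉N) = dec-lam y M x N x≢y y∉N w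
root-decreases w (r-appˡ M P x N x∈M) = dec-appˡ M P x N x∈M w
root-decreases w (r-appʳ M P x N x∈P) = dec-appʳ M P x N x∈P w
root-decreases w (r-era y M x N x≢y) = dec-era y M x N x≢y w
root-decreases w (r-era-x M x N) = dec-era-x M x N w
root-decreases w (r-dup y y₁ y₂ M x N x≢y y₁∉N y₂∉N) = dec-dup y y₁ y₂ M x N x≢y y₁∉N y₂∉N w
root-decreases w (r-dup-x x₁ x₂ M x N Y Z lY lZ uYZ fresh) = dec-dup-x x₁ x₂ M x N Y Z lY lZ uYZ fresh w

-- Every root redex is an explicit substitution, so terms of Λ® are normal.
Λ®-no-redex : ∀ {M N} → Λ® M → ¬ (M ⟶₀ N)
Λ®-no-redex () (r-var _ _)
Λ®-no-redex () (r-lam _ _ _ _ _ _)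
Λ®-no-redex () (r-appˡ _ _ _ _ _)
Λ®-no-redex () (r-appʳ _ _ _ _ _)
Λ®-no-redex () (r-era _ _ _ _ _)
Λ®-no-redex () (r-era-x _ _ _)
Λ®-no-redex () (r-dup _ _ _ _ _ _ _ _ _)
Λ®-no-redex () (r-dup-x _ _ _ _ _ _ _ _ _ _ _)

Λ®-normal : ∀ {M N} → Λ® M → ¬ (M ⟶c N)
Λ®-normal w (root r) = Λ®-no-redex w r
Λ®-normal (lam _ _ w _) (lam x s) = Λ®-normal w s
Λ®-normal (app _ _ w _ _) (appˡ N s) = Λ®-normal w s
Λ®-normal (app _ _ _ w _) (appʳ M s) = Λ®-normal w s
Λ®-normal (era _ _ w _) (era x s) = Λ®-normal w s
Λ®-normal (dup _ _ _ _ w _ _ _ _) (dup x x₁ x₂ s) = Λ®-normal w s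

-- The measure is monotone in the weight and strictly monotone in the measure
-- of each immediate subterm, so decrease propagates through contexts.
step-decreases : ∀ {M N} → Λ®[/] M → M ⟶c N → Decreases M N
step-decreases w (root r) = root-decreases w r
step-decreases (lam _ _ w _) (lam x s) ρ with step-decreases w s (ρ [ x ≔ 0 ])
... | ⟦⟧< , φ≤ = +-mono-≤-< (s≤s φ≤) ⟦⟧< , φ≤
step-decreases (app _ _ w _ _) (appˡ N s) ρ with step-decreases w s ρ
... | ⟦⟧< , φ≤ = +-mono-≤-< (s≤s (+-monoˡ-≤ (φ N ρ) φ≤)) (+-monoˡ-< (⟦ N ⟧ ρ) ⟦⟧<) , +-monoˡ-≤ (φ N ρ) φ≤
step-decreases (app _ _ _ w _) (appʳ M s) ρ with step-decreases w s ρ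
... | ⟦⟧< , φ≤ = +-mono-≤-< (s≤s (+-monoʳ-≤ (φ M ρ) φ≤)) (+-monoʳ-< (⟦ M ⟧ ρ) ⟦⟧<) , +-monoʳ-≤ (φ M ρ) φ≤
step-decreases (era _ _ w _) (era x s) ρ with step-decreases w s ρ
... | ⟦⟧< , φ≤ = +-mono-≤-< (*-monoʳ-≤ (suc (ρ x)) (s≤s (+-monoʳ-≤ (ρ x) φ≤))) ⟦⟧< , +-monoʳ-≤ (ρ x) φ≤
step-decreases (dup _ _ _ _ w _ _ _ _) (dup x x₁ x₂ s) ρ with step-decreases w s (ρ [ x₁ ≔ ρ x ] [ x₂ ≔ ρ x ])
... | ⟦⟧< , φ≤ = +-mono-≤-< (*-monoʳ-≤ (suc (ρ x)) (s≤s φ≤)) ⟦⟧< , φ≤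
step-decreases (sub _ _ N w _ _ _) (subˡ x N s) ρ
  with step-decreases w s (ρ [ x ≔ φ N ρ ]) | step-decreases w s (ρ [ x ≔ Wt (⟦ N ⟧ ρ) ])
... | _ , φ≤ | ⟦⟧< , _ = +-mono-≤-< (+-monoˡ-≤ (⟦ N ⟧ ρ) (s≤s φ≤)) ⟦⟧< , φ≤
step-decreases (sub _ _ _ _ _ nN _) (subʳ M x s) ρ = ⊥-elim (Λ®-normal nN s)

-- A step of →^{[/]} from a well-formed term decreases the measure: the
-- surrounding α-conversions preserve it and well-formedness.
⟶[/]-decreases : ∀ {M N} → Λ®[/] M → M ⟶[/] N → ∀ ρ → ⟦ N ⟧ ρ < ⟦ M ⟧ ρ
⟶[/]-decreases w (M′ , N′ , M≡αM′ , M′⟶N′ , N′≡αN) ρ =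
  subst₂ _<_ (proj₂ (α-≃ N′≡αN ρ)) (≡-sym (proj₂ (α-≃ M≡αM′ ρ)))
    (proj₁ (step-decreases (to (α-Λ®[/] M≡αM′) w) M′⟶N′ ρ))

no-infinite-descent : (g : ℕ → ℕ) → ¬ (∀ k → g (suc k) < g k)
no-infinite-descent g down = go 0 (<-wellFounded (g 0))
  where
  go : ∀ k → ¬ Acc _<_ (g k)
  go k (acc rs) = go (suc k) (rs (down k))

mainTheorem5 : ¬ (Σ (ℕ → Term) λ Q → ((n : ℕ) → Λ®[/] (Q n)) × ((n : ℕ) → Q n ⟶[/] Q (suc n)))
mainTheorem5 (Q , wf , steps) =
  no-infinite-descent (λ k → ⟦ Q k ⟧ ρ₀) (λ k → ⟶[/]-decreases (wf k) (steps k) ρ₀)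
  where
  ρ₀ : Env
  ρ₀ _ = 0
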